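{- Let $F$ be the simplicial complex on vertex set $\{v_1,\dots,v_5\}$ whose edge set is the downward closure of $\{v_1v_2v_3,\ v_2v_3v_4,\ v_2v_5,\ v_3v_5\}$. For every $\varepsilon>0$ there is $n_0\in\mathbb N$ such that for every $n\ge n_0$, $$\Big(\frac43-\varepsilon\Big)\binom n2\le \mathrm{ex}(n,F)\le \Big(\frac43+\varepsilon\Big)\binom n2.$$
   Context: A simplicial complex is a pair $H=(V,E)$ with $E\subseteq\mathscr P(V)$ closed under taking subsets; all sets in $E$ (including the empty set and singletons) count as edges. $H$ contains a copy of $F$ if there is an injection $\varphi:V(F)\to V(H)$ with $\varphi(e)\in E(H)$ for every $e\in E(F)$. $\mathrm{ex}(n,F)$ is the maximum number of edges of a simplicial complex on $n$ vertices containing no copy of $F$. -}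

module Defs where

open import Data.Nat using (ℕ; zero; suc)
open import Data.Nat.Combinatorics using (_C_)
open import Data.Bool using (Bool; true; false; if_then_else_)
open import Data.Fin using (Fin; zero; suc)
open import Data.Fin.Subset using (Subset; inside; outside; ⊥; ⁅_⁆; _∪_; _⊆_)
open import Data.Vec using (Vec; []; _∷_)
open import Data.List using (List; []; _∷_; map; _++_; length; filterᵇ)
open import Data.List.Membership.Propositional using (_∈_)
open import Data.Product using (Σ; _×_; ∃-syntax)
open import Data.Integer using (+_)
open import Data.Rational using (ℚ; _/_)
open import Function.Definitions using (Injective)
open import Relation.Binary.PropositionalEquality using (_≡_)
open import Function using (_∘_)

record Complex (n : ℕ) : Set where
  field
    edge     : Subset n → Bool
    downward : ∀ (s t : Subset n) → t ⊆ s → edge s ≡ true → edge t ≡ true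
open Complex public

allSubsets : (n : ℕ) → List (Subset n)
allSubsets zero    = [] ∷ []
allSubsets (suc n) = map (outside ∷_) (allSubsets n) ++ map (inside ∷_) (allSubsets n)

-- number of edges (including the empty set and singletons)
edgeCount : ∀ {n} → Complex n → ℕ
edgeCount {n} H = length (filterᵇ (edge H) (allSubsets n))

image : ∀ {m n} → (Fin m → Fin n) → Subset m → Subset n
image φ []            = ⊥
image φ (inside ∷ p)  = ⁅ φ zero ⁆ ∪ image (φ ∘ suc) p
image φ (outside ∷ p) = image (φ ∘ suc) p

-- F: vertices v1..v5 = Fin 5 (0..4); generating faces v1v2v3, v2v3v4, v2v5, v3v5
generatorsF : List (Subset 5)
generatorsF =
    (inside  ∷ inside ∷ inside ∷ outside ∷ outside ∷ [])
  ∷ (outside ∷ inside ∷ inside ∷ inside  ∷ outside ∷ [])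
  ∷ (outside ∷ inside ∷ outside ∷ outside ∷ inside ∷ [])
  ∷ (outside ∷ outside ∷ inside ∷ outside ∷ inside ∷ [])
  ∷ []

EdgeF : Subset 5 → Set
EdgeF e = ∃[ g ] (g ∈ generatorsF × e ⊆ g)

ContainsF : ∀ {n} → Complex n → Set
ContainsF {n} H =
  Σ (Fin 5 → Fin n) λ φ → Injective _≡_ _≡_ φ ×
    (∀ (e : Subset 5) → EdgeF e → edge H (image φ e) ≡ true)

choose2ℚ : ℕ → ℚ
choose2ℚ n = + (n C 2) / 1

ℕtoℚ : ℕ → ℚ
ℕtoℚ k = + k / 1

module Submission where

-- Let H be F-free on n vertices.  A 5-vertex edge would contain F, so
-- e(H) ≤ 1 + n + c₂ + c₃ + c₄, where cₖ counts the edges with k vertices.  Give each pair ab the weight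
-- ω(ab) = 12[ab ∈ H] + 4 t(ab) + q(ab), where t(ab) counts the vertices c with abc ∈ H and q(ab) the
-- ordered pairs cd with abcd ∈ H.  F-freeness gives t(ab) ≤ 2, and if t(ab) ≥ 2 and abc ∉ H then ac ∉ H
-- or bc ∉ H (otherwise the two triangles on ab together with c form F).  Hence the weights of the three
-- pairs of a triple sum to at most 48, or 66 when the triple is an edge, and averaging over ordered
-- triples gives 72 (n − 2) (c₂ + c₃ + c₄) ≤ 48 n³ + 36 n², that is e(H) ≤ (2/3) n² + O(n).
--
-- On ℤ/N take every set of at most two elements and every triple summing to 0.  Two
-- triangles v₁v₂v₃ and v₂v₃v₄ force v₁ = v₄, so there is no copy of F, while all but O(N) ordered pairs
-- lie in exactly one triangle; this gives (2/3) N² − O(N) edges.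

open import Data.Nat.Base using (ℕ)

module Indicators where

  open import Data.Nat using (_+_; _*_; _≤_; z≤n; s≤s)
  open import Data.Nat.Properties using (≤-refl; +-identityʳ)
  open import Data.Nat.Tactic.RingSolver using (solve-∀)
  open import Data.Bool using (Bool; true; false; not; _∧_; _∨_)
  open import Data.Fin using (Fin)
  open import Data.Fin.Properties using (_≟_)
  open import Data.Product using (_×_; _,_)
  open import Data.Sum using (_⊎_; inj₁; inj₂)
  open import Function.Definitions using (Injective)
  open import Relation.Nullary using (Dec; does; yes; no; contradiction)
  open import Relation.Nullary.Decidable using (dec-true; dec-false)
  open import Relation.Binary.PropositionalEquality

  𝟙 : Bool → ℕ
  𝟙 true  = 1
  𝟙 false = 0

  𝟙≤1 : ∀ b → 𝟙 b ≤ 1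
  𝟙≤1 true  = s≤s z≤n
  𝟙≤1 false = z≤n

  𝟙-∧ : ∀ a b → 𝟙 (a ∧ b) ≡ 𝟙 a * 𝟙 b
  𝟙-∧ true  b = sym (+-identityʳ (𝟙 b))
  𝟙-∧ false b = refl

  𝟙-∨ : ∀ a b → 𝟙 (a ∨ b) ≤ 𝟙 a + 𝟙 b
  𝟙-∨ true  b = s≤s z≤n
  𝟙-∨ false b = ≤-refl

  𝟙+𝟙-not : ∀ b → 𝟙 b + 𝟙 (not b) ≡ 1
  𝟙+𝟙-not true  = refl
  𝟙+𝟙-not false = refl

  ∧-true : ∀ {a b} → a ∧ b ≡ true → a ≡ true × b ≡ true
  ∧-true {true} {true} _ = refl , refl

  not-true : ∀ {a} → not a ≡ true → a ≡ false
  not-true {false} _ = refl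

  does-true : ∀ {P : Set} (P? : Dec P) → does P? ≡ true → P
  does-true (yes p) _ = p

  δ : ∀ {n} → Fin n → Fin n → ℕ
  δ i j = 𝟙 (does (i ≟ j))

  δᶜ : ∀ {n} → Fin n → Fin n → ℕ
  δᶜ i j = 𝟙 (not (does (i ≟ j)))

  δᶜ-sym : ∀ {n} (i j : Fin n) → δᶜ i j ≡ δᶜ j i
  δᶜ-sym i j with i ≟ j | j ≟ i
  ... | yes _    | yes _    = refl
  ... | no  _    | no  _    = refl
  ... | yes refl | no  i≢i  = contradiction refl i≢i
  ... | no  i≢i  | yes refl = contradiction refl i≢i

  δ-refl : ∀ {n} (i : Fin n) → δ i i ≡ 1
  δ-refl i = cong 𝟙 (dec-true (i ≟ i) refl)

  δᶜ-refl : ∀ {n} (i : Fin n) → δᶜ i i ≡ 0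
  δᶜ-refl i = cong (λ b → 𝟙 (not b)) (dec-true (i ≟ i) refl)

  δᶜ-≢ : ∀ {n} {i j : Fin n} → i ≢ j → δᶜ i j ≡ 1
  δᶜ-≢ {i = i} {j} i≢j = cong (λ b → 𝟙 (not b)) (dec-false (i ≟ j) i≢j)

  δ₃ : ∀ {n} → Fin n → Fin n → Fin n → ℕ
  δ₃ i j k = δᶜ i j * (δᶜ i k * δᶜ j k)

  δ₃-cases : ∀ {n} (i j k : Fin n) → δ₃ i j k ≡ 0 ⊎ (δ₃ i j k ≡ 1 × i ≢ j × j ≢ k × i ≢ k)
  δ₃-cases i j k with i ≟ j | i ≟ k | j ≟ k
  ... | yes _  | _      | _      = inj₁ refl
  ... | no _   | yes _  | _      = inj₁ refl
  ... | no _   | no _   | yes _  = inj₁ refl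
  ... | no i≢j | no i≢k | no j≢k = inj₂ (refl , i≢j , j≢k , i≢k)

  δ₃-rotate : ∀ {n} (i j k : Fin n) → δ₃ j k i ≡ δ₃ i j k
  δ₃-rotate i j k rewrite δᶜ-sym j i | δᶜ-sym k i = reorder (δᶜ i j) (δᶜ i k) (δᶜ j k)
    where
    reorder : ∀ x y z → z * (x * y) ≡ x * (y * z)
    reorder = solve-∀

  injective⇒≢ : ∀ {m n} {φ : Fin m → Fin n} → Injective _≡_ _≡_ φ → ∀ {i j} → i ≢ j → φ i ≢ φ j
  injective⇒≢ φ-inj i≢j φi≡φj = i≢j (φ-inj φi≡φj)

module Sums where

  open import Data.Nat using (zero; suc; _+_; _*_; _∸_; _≤_; z≤n)
  open import Data.Nat.Properties hiding (_≟_; suc-injective)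
  open import Data.Bool using (Bool; true; false)
  open import Data.Fin using (Fin; zero; suc)
  open import Data.Fin.Properties using (_≟_; suc-injective)
  open import Data.Product using (Σ-syntax; _×_; _,_)
  open import Function.Definitions using (Injective)
  open import Function using (case_of_)
  open import Data.Nat.Tactic.RingSolver using (solve-∀)
  open import Relation.Nullary using (does; yes; no; contradiction)
  open import Relation.Binary.PropositionalEquality
  open Indicators

  open import Algebra.Properties.Semiring.Sum +-*-semiring public
    using (sum; sum-syntax; sum-cong-≗; ∑-distrib-+; ∑-comm; *-distribˡ-sum; *-distribʳ-sum)

  ∑-const : ∀ n c → ∑[ i < n ] c ≡ n * c
  ∑-const zero    c = refl
  ∑-const (suc n) c = cong (c +_) (∑-const n c)

  ∑-zero : ∀ {n} {f : Fin n → ℕ} → (∀ i → f i ≡ 0) → sum f ≡ 0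
  ∑-zero {n} f≡0 = trans (sum-cong-≗ f≡0) (trans (∑-const n 0) (*-zeroʳ n))

  ∑-mono-≤ : ∀ {n} {f g : Fin n → ℕ} → (∀ i → f i ≤ g i) → sum f ≤ sum g
  ∑-mono-≤ {zero}  f≤g = z≤n
  ∑-mono-≤ {suc n} f≤g = +-mono-≤ (f≤g zero) (∑-mono-≤ (λ i → f≤g (suc i)))

  ∑-≤-const : ∀ {n} c {f : Fin n → ℕ} → (∀ i → f i ≤ c) → sum f ≤ n * c
  ∑-≤-const {n} c f≤c = ≤-trans (∑-mono-≤ f≤c) (≤-reflexive (∑-const n c))

  ∑-δ : ∀ {n} i (f : Fin n → ℕ) → ∑[ j < n ] (δ i j * f j) ≡ f i
  ∑-δ {suc n} zero    f = trans (cong₂ _+_ (+-identityʳ (f zero)) (trans (∑-const n 0) (*-zeroʳ n)))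
                                (+-identityʳ (f zero))
  ∑-δ {suc n} (suc i) f = ∑-δ i (λ j → f (suc j))

  distinctWitnesses : ∀ {n} k (c : Fin n → Bool) → k ≤ ∑[ j < n ] 𝟙 (c j) →
                      Σ[ φ ∈ (Fin k → Fin n) ] Injective _≡_ _≡_ φ × (∀ i → c (φ i) ≡ true)
  distinctWitnesses zero    c _ = (λ ()) , (λ {i} → case i of λ ()) , λ ()
  distinctWitnesses {zero}  (suc k) c ()
  distinctWitnesses {suc n} (suc k) c k<∑ with c zero in c₀
  ... | true  = let (φ , φ-inj , cφ) = distinctWitnesses k (λ j → c (suc j)) (≤-pred k<∑)
                in  cons φ , cons-inj φ-inj , λ { zero → c₀ ; (suc i) → cφ i }
    where
    cons : ∀ {m} → (Fin m → Fin n) → Fin (suc m) → Fin (suc n)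
    cons φ zero    = zero
    cons φ (suc i) = suc (φ i)
    cons-inj : ∀ {m} {φ : Fin m → Fin n} → Injective _≡_ _≡_ φ → Injective _≡_ _≡_ (cons φ)
    cons-inj φ-inj {zero}  {zero}  _ = refl
    cons-inj φ-inj {suc i} {suc j} e = cong suc (φ-inj (suc-injective e))
  ... | false = let (φ , φ-inj , cφ) = distinctWitnesses (suc k) (λ j → c (suc j)) k<∑
                in  (λ i → suc (φ i)) , (λ e → φ-inj (suc-injective e)) , cφ

  ∑-δ-one : ∀ {n} (i : Fin n) → ∑[ j < n ] δ i j ≡ 1
  ∑-δ-one i = trans (sum-cong-≗ (λ j → sym (*-identityʳ (δ i j)))) (∑-δ i (λ _ → 1))

  ∑-unique : ∀ {n} (c : Fin n → Bool) x → c x ≡ true → (∀ y → c y ≡ true → y ≡ x) → ∑[ y < n ] 𝟙 (c y) ≡ 1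
  ∑-unique c x cx unique = trans (sum-cong-≗ 𝟙c≡δ) (∑-δ-one x)
    where
    𝟙c≡δ : ∀ y → 𝟙 (c y) ≡ δ x y
    𝟙c≡δ y with x ≟ y | c y in cy
    ... | yes refl | _     = cong 𝟙 (trans (sym cy) cx)
    ... | no  _    | false = refl
    ... | no  x≢y  | true  = contradiction (sym (unique y cy)) x≢y

  ∑-δᶜ : ∀ {n} i (f : Fin n → ℕ) → ∑[ j < n ] (δᶜ i j * f j) + f i ≡ sum f
  ∑-δᶜ {n} i f = begin
    ∑[ j < n ] (δᶜ i j * f j) + f i                    ≡⟨ +-comm _ (f i) ⟩
    f i + ∑[ j < n ] (δᶜ i j * f j)                    ≡⟨ cong (_+ ∑[ j < n ] (δᶜ i j * f j)) (∑-δ i f) ⟨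
    ∑[ j < n ] (δ i j * f j) + ∑[ j < n ] (δᶜ i j * f j) ≡⟨ ∑-distrib-+ (λ j → δ i j * f j) (λ j → δᶜ i j * f j) ⟨
    ∑[ j < n ] (δ i j * f j + δᶜ i j * f j)            ≡⟨ sum-cong-≗ split ⟩
    sum f                                              ∎
    where
    open ≡-Reasoning
    split : ∀ j → δ i j * f j + δᶜ i j * f j ≡ f j
    split j = trans (sym (*-distribʳ-+ (f j) (δ i j) (δᶜ i j)))
                    (trans (cong (_* f j) (𝟙+𝟙-not (does (i ≟ j)))) (+-identityʳ (f j)))

  ∑-δᶜ-δᶜ : ∀ {n} {i j : Fin n} → i ≢ j → ∑[ k < n ] (δᶜ i k * δᶜ j k) ≡ n ∸ 2
  ∑-δᶜ-δᶜ {n} {i} {j} i≢j = begin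
    ∑δᶜδᶜ          ≡⟨ m+n∸n≡m ∑δᶜδᶜ 2 ⟨
    ∑δᶜδᶜ + 2 ∸ 2  ≡⟨ cong (_∸ 2) total ⟩
    n ∸ 2          ∎
    where
    open ≡-Reasoning
    ∑δᶜδᶜ = ∑[ k < n ] (δᶜ i k * δᶜ j k)
    cover : ∀ k → δᶜ i k * δᶜ j k + (δ i k + δ j k) ≡ 1
    cover k with i ≟ k | j ≟ k
    ... | yes refl | yes refl = contradiction refl i≢j
    ... | yes _    | no  _    = refl
    ... | no  _    | yes _    = refl
    ... | no  _    | no  _    = refl
    total : ∑δᶜδᶜ + 2 ≡ n
    total = begin
      ∑δᶜδᶜ + 2                                             ≡⟨ cong (∑δᶜδᶜ +_) (cong₂ _+_ (∑-δ-one i) (∑-δ-one j)) ⟨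
      ∑δᶜδᶜ + (∑[ k < n ] δ i k + ∑[ k < n ] δ j k)         ≡⟨ cong (∑δᶜδᶜ +_) (∑-distrib-+ (δ i) (δ j)) ⟨
      ∑δᶜδᶜ + ∑[ k < n ] (δ i k + δ j k)                    ≡⟨ ∑-distrib-+ (λ k → δᶜ i k * δᶜ j k) (λ k → δ i k + δ j k) ⟨
      ∑[ k < n ] (δᶜ i k * δᶜ j k + (δ i k + δ j k))        ≡⟨ sum-cong-≗ cover ⟩
      ∑[ k < n ] 1                                          ≡⟨ trans (∑-const n 1) (*-identityʳ n) ⟩
      n                                                     ∎

  ∑² : ∀ {n} → (Fin n → Fin n → ℕ) → ℕ
  ∑² {n} f = ∑[ i < n ] ∑[ j < n ] f i j

  ∑³ : ∀ {n} → (Fin n → Fin n → Fin n → ℕ) → ℕ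
  ∑³ {n} f = ∑[ i < n ] ∑[ j < n ] ∑[ k < n ] f i j k

  module _ {n : ℕ} where

    ∑²-cong : {f g : Fin n → Fin n → ℕ} → (∀ i j → f i j ≡ g i j) → ∑² f ≡ ∑² g
    ∑²-cong f≗g = sum-cong-≗ (λ i → sum-cong-≗ (f≗g i))

    ∑²-distrib-+ : ∀ (f g : Fin n → Fin n → ℕ) → ∑² (λ i j → f i j + g i j) ≡ ∑² f + ∑² g
    ∑²-distrib-+ f g = trans (sum-cong-≗ (λ i → ∑-distrib-+ (f i) (g i)))
                             (∑-distrib-+ (λ i → ∑[ j < n ] f i j) (λ i → ∑[ j < n ] g i j))

    ∑²-distribˡ : ∀ c (f : Fin n → Fin n → ℕ) → ∑² (λ i j → c * f i j) ≡ c * ∑² f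
    ∑²-distribˡ c f = sym (trans (*-distribˡ-sum c (λ i → ∑[ j < n ] f i j)) (sum-cong-≗ (λ i → *-distribˡ-sum c (f i))))

    ∑²-mono-≤ : {f g : Fin n → Fin n → ℕ} → (∀ i j → f i j ≤ g i j) → ∑² f ≤ ∑² g
    ∑²-mono-≤ f≤g = ∑-mono-≤ (λ i → ∑-mono-≤ (f≤g i))

    ∑²-≤-const : ∀ c {f : Fin n → Fin n → ℕ} → (∀ i j → f i j ≤ c) → ∑² f ≤ n * (n * c)
    ∑²-≤-const c f≤c = ∑-≤-const (n * c) (λ i → ∑-≤-const c (f≤c i))

    ∑²-rows : ∀ c (f : Fin n → Fin n → ℕ) → (∀ i → ∑[ j < n ] f i j ≡ c) → ∑² f ≡ n * c
    ∑²-rows c f rows = trans (sum-cong-≗ rows) (∑-const n c)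

    ∑²-columns : ∀ c (f : Fin n → Fin n → ℕ) → (∀ j → ∑[ i < n ] f i j ≡ c) → ∑² f ≡ n * c
    ∑²-columns c f columns = trans (∑-comm f) (∑²-rows c (λ j i → f i j) columns)

    ∑²-δᶜ : ∑² (δᶜ {n}) + n ≡ n * n
    ∑²-δᶜ = begin
      ∑² (δᶜ {n}) + n                          ≡⟨ cong (∑² (δᶜ {n}) +_) (trans (∑-const n 1) (*-identityʳ n)) ⟨
      ∑² (δᶜ {n}) + ∑[ i < n ] 1               ≡⟨ ∑-distrib-+ (λ i → ∑[ j < n ] δᶜ i j) (λ (_ : Fin n) → 1) ⟨
      ∑[ i < n ] (∑[ j < n ] δᶜ i j + 1)               ≡⟨ sum-cong-≗ row ⟩
      ∑[ i < n ] n                                     ≡⟨ ∑-const n n ⟩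
      n * n                                            ∎
      where
      open ≡-Reasoning
      row : ∀ i → ∑[ j < n ] δᶜ i j + 1 ≡ n
      row i = trans (cong (_+ 1) (sum-cong-≗ (λ j → sym (*-identityʳ (δᶜ i j)))))
                    (trans (∑-δᶜ i (λ _ → 1)) (trans (∑-const n 1) (*-identityʳ n)))

    ∑³-cong : {f g : Fin n → Fin n → Fin n → ℕ} → (∀ i j k → f i j k ≡ g i j k) → ∑³ f ≡ ∑³ g
    ∑³-cong f≗g = sum-cong-≗ (λ i → ∑²-cong (f≗g i))

    ∑³-distrib-+ : ∀ (f g : Fin n → Fin n → Fin n → ℕ) → ∑³ (λ i j k → f i j k + g i j k) ≡ ∑³ f + ∑³ g
    ∑³-distrib-+ f g = trans (sum-cong-≗ (λ i → ∑²-distrib-+ (f i) (g i))) (∑-distrib-+ (λ i → ∑² (f i)) (λ i → ∑² (g i)))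

    ∑³-distribˡ : ∀ c (f : Fin n → Fin n → Fin n → ℕ) → ∑³ (λ i j k → c * f i j k) ≡ c * ∑³ f
    ∑³-distribˡ c f = sym (trans (*-distribˡ-sum c (λ i → ∑² (f i))) (sum-cong-≗ (λ i → sym (∑²-distribˡ c (f i)))))

    ∑³-mono-≤ : {f g : Fin n → Fin n → Fin n → ℕ} → (∀ i j k → f i j k ≤ g i j k) → ∑³ f ≤ ∑³ g
    ∑³-mono-≤ f≤g = ∑-mono-≤ (λ i → ∑²-mono-≤ (f≤g i))

    ∑³-≤-const : ∀ c {f : Fin n → Fin n → Fin n → ℕ} → (∀ i j k → f i j k ≤ c) → ∑³ f ≤ n * (n * (n * c))
    ∑³-≤-const c f≤c = ∑-≤-const (n * (n * c)) (λ i → ∑²-≤-const c (f≤c i))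

    ∑³-rotate : ∀ (f : Fin n → Fin n → Fin n → ℕ) → ∑³ f ≡ ∑³ (λ i j k → f j k i)
    ∑³-rotate f = sym (trans (∑-comm (λ i j → ∑[ k < n ] f j k i)) (sum-cong-≗ (λ j → ∑-comm (λ i k → f j k i))))

  ∑-δ₃-const : ∀ {n} (i j : Fin n) c → ∑[ k < n ] (δ₃ i j k * c) ≡ (n ∸ 2) * (δᶜ i j * c)
  ∑-δ₃-const {n} i j c with i ≟ j
  ... | yes refl = trans (trans (∑-const n 0) (*-zeroʳ n)) (sym (*-zeroʳ (n ∸ 2)))
  ... | no i≢j   = begin
    ∑[ k < n ] (1 * (δᶜ i k * δᶜ j k) * c)     ≡⟨ sum-cong-≗ (λ k → cong (_* c) (*-identityˡ (δᶜ i k * δᶜ j k))) ⟩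
    ∑[ k < n ] (δᶜ i k * δᶜ j k * c)           ≡⟨ *-distribʳ-sum c (λ k → δᶜ i k * δᶜ j k) ⟨
    ∑[ k < n ] (δᶜ i k * δᶜ j k) * c           ≡⟨ cong (_* c) (∑-δᶜ-δᶜ i≢j) ⟩
    (n ∸ 2) * c                                ≡⟨ cong ((n ∸ 2) *_) (*-identityˡ c) ⟨
    (n ∸ 2) * (1 * c)                          ∎
    where open ≡-Reasoning

  ∑³-δ₃-pairs : ∀ {n} (f : Fin n → Fin n → ℕ) → (∀ a b → f a b ≡ f b a) →
                ∑³ (λ i j k → δ₃ i j k * (f i j + f j k + f i k)) ≡ 3 * ((n ∸ 2) * ∑² (λ i j → δᶜ i j * f i j))
  ∑³-δ₃-pairs {n} f f-sym = begin
    ∑³ (λ i j k → δ₃ i j k * (f i j + f j k + f i k))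
      ≡⟨ ∑³-cong (λ i j k → distrib (δ₃ i j k) (f i j) (f j k) (f i k)) ⟩
    ∑³ (λ i j k → δ₃ i j k * f i j + δ₃ i j k * f j k + δ₃ i j k * f i k)
      ≡⟨ ∑³-distrib-+ (λ i j k → δ₃ i j k * f i j + δ₃ i j k * f j k) (λ i j k → δ₃ i j k * f i k) ⟩
    ∑³ (λ i j k → δ₃ i j k * f i j + δ₃ i j k * f j k) + Z
      ≡⟨ cong (_+ Z) (∑³-distrib-+ (λ i j k → δ₃ i j k * f i j) (λ i j k → δ₃ i j k * f j k)) ⟩
    X + Y + Z
      ≡⟨ cong₂ (λ y z → X + y + z) (trans Y≡Z Z≡X) Z≡X ⟩
    X + X + X
      ≡⟨ thrice X ⟩
    3 * X
      ≡⟨ cong (3 *_) X≡ ⟩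
    3 * ((n ∸ 2) * ∑² (λ i j → δᶜ i j * f i j))
      ∎
    where
    open ≡-Reasoning
    X Y Z : ℕ
    X = ∑³ (λ i j k → δ₃ i j k * f i j)
    Y = ∑³ (λ i j k → δ₃ i j k * f j k)
    Z = ∑³ (λ i j k → δ₃ i j k * f i k)
    Z≡X : Z ≡ X
    Z≡X = trans (∑³-rotate (λ i j k → δ₃ i j k * f i k)) (∑³-cong (λ i j k → cong₂ _*_ (δ₃-rotate i j k) (f-sym j i)))
    Y≡Z : Y ≡ Z
    Y≡Z = trans (∑³-rotate (λ i j k → δ₃ i j k * f j k)) (∑³-cong (λ i j k → cong₂ _*_ (δ₃-rotate i j k) (f-sym k i)))
    X≡ : X ≡ (n ∸ 2) * ∑² (λ i j → δᶜ i j * f i j)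
    X≡ = trans (∑²-cong (λ i j → ∑-δ₃-const i j (f i j))) (∑²-distribˡ (n ∸ 2) (λ i j → δᶜ i j * f i j))
    distrib : ∀ d x y z → d * (x + y + z) ≡ d * x + d * y + d * z
    distrib = solve-∀
    thrice : ∀ x → x + x + x ≡ 3 * x
    thrice = solve-∀

module Subsets where

  open import Data.Nat using (ℕ; zero; suc; _+_; _*_; _≤_; _<_; s≤s)
  open import Data.Nat.Properties using (<⇒≱; ≤-trans; ≤-reflexive; *-identityʳ; +-identityʳ; module ≤-Reasoning)
  open import Data.Bool using (true; false; not; _∨_)
  open import Data.Fin using (Fin; zero; suc)
  open import Data.Fin.Properties using (_≟_)
  open import Data.Fin.Subset
    using (Subset; inside; outside; ⊥; ⁅_⁆; _∪_; _⊆_; _∈_; _∉_; ∣_∣)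
  open import Data.Fin.Subset.Properties
    using (∪-assoc; ∪-comm; ∪-identityʳ; x∈p∪q⁻; x∈p∪q⁺; x∈⁅x⁆; x∈⁅y⁆⇒x≡y; q⊆p∪q; ∣⊥∣≡0; ⊆-antisym; _∈?_; p⊂q⇒∣p∣<∣q∣)
  open import Data.Vec using ([]; _∷_; lookup)
  open import Data.Vec.Properties using (lookup-zipWith; lookup-replicate; lookup⇒[]=; []=⇒lookup)
  open import Data.Product using (Σ-syntax; _×_; _,_)
  open import Data.Sum using (inj₁; inj₂)
  open import Data.Empty using () renaming (⊥ to ⊥-Empty)
  open import Function.Definitions using (Injective)
  open import Relation.Nullary using (does; yes; no; contradiction)
  open import Relation.Binary.PropositionalEquality
  open Indicators
  open Sums

  infixr 5 _◂_
  _◂_ : ∀ {n} → Fin n → Subset n → Subset n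
  x ◂ p = ⁅ x ⁆ ∪ p

  pair : ∀ {n} → Fin n → Fin n → Subset n
  pair a b = b ◂ a ◂ ⊥

  ◂-swap : ∀ {n} (x y : Fin n) p → x ◂ y ◂ p ≡ y ◂ x ◂ p
  ◂-swap x y p = begin
    ⁅ x ⁆ ∪ (⁅ y ⁆ ∪ p)  ≡⟨ ∪-assoc ⁅ x ⁆ ⁅ y ⁆ p ⟨
    (⁅ x ⁆ ∪ ⁅ y ⁆) ∪ p  ≡⟨ cong (_∪ p) (∪-comm ⁅ x ⁆ ⁅ y ⁆) ⟩
    (⁅ y ⁆ ∪ ⁅ x ⁆) ∪ p  ≡⟨ ∪-assoc ⁅ y ⁆ ⁅ x ⁆ p ⟩
    ⁅ y ⁆ ∪ (⁅ x ⁆ ∪ p)  ∎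
    where open ≡-Reasoning

  pair-comm : ∀ {n} (a b : Fin n) → pair a b ≡ pair b a
  pair-comm a b = ◂-swap b a ⊥

  subsetSum : ∀ {n} → Subset n → (Fin n → ℕ) → ℕ
  subsetSum {n} p w = ∑[ i < n ] (𝟙 (lookup p i) * w i)


  p⊆x◂p : ∀ {n} (x : Fin n) p → p ⊆ x ◂ p
  p⊆x◂p x p = q⊆p∪q ⁅ x ⁆ p

  ◂-mono : ∀ {n} (x : Fin n) {p q} → p ⊆ q → x ◂ p ⊆ x ◂ q
  ◂-mono x {p} p⊆q y∈ with x∈p∪q⁻ ⁅ x ⁆ p y∈
  ... | inj₁ y∈⁅x⁆ = x∈p∪q⁺ (inj₁ y∈⁅x⁆)
  ... | inj₂ y∈p   = x∈p∪q⁺ (inj₂ (p⊆q y∈p))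

  lookup-⁅⁆ : ∀ {n} (x y : Fin n) → lookup ⁅ x ⁆ y ≡ does (x ≟ y)
  lookup-⁅⁆ zero    zero    = refl
  lookup-⁅⁆ zero    (suc y) = lookup-replicate y outside
  lookup-⁅⁆ (suc x) zero    = refl
  lookup-⁅⁆ (suc x) (suc y) = lookup-⁅⁆ x y

  lookup-◂ : ∀ {n} (x : Fin n) p y → lookup (x ◂ p) y ≡ does (x ≟ y) ∨ lookup p y
  lookup-◂ x p y = trans (lookup-zipWith _∨_ y ⁅ x ⁆ p) (cong (_∨ lookup p y) (lookup-⁅⁆ x y))

  lookup-◂⊥ : ∀ {n} (x y : Fin n) → lookup (x ◂ ⊥) y ≡ does (x ≟ y)
  lookup-◂⊥ x y = trans (cong (λ p → lookup p y) (∪-identityʳ ⁅ x ⁆)) (lookup-⁅⁆ x y)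

  lookup-pair≡false : ∀ {n} {a b x : Fin n} → lookup (pair a b) x ≡ false → x ≢ a × x ≢ b
  lookup-pair≡false {a = a} {b} {x} ab∌x = (λ { refl → true≢false a∈ab }) , (λ { refl → true≢false b∈ab })
    where
    true≢false : lookup (pair a b) x ≡ true → ⊥-Empty
    true≢false ab∋x with () ← trans (sym ab∋x) ab∌x
    a∈ab : lookup (pair a b) a ≡ true
    a∈ab = []=⇒lookup (p⊆x◂p b (a ◂ ⊥) (x∈p∪q⁺ (inj₁ (x∈⁅x⁆ a))))
    b∈ab : lookup (pair a b) b ≡ true
    b∈ab = []=⇒lookup (x∈p∪q⁺ (inj₁ (x∈⁅x⁆ b)))

  𝟙-∉-pair : ∀ {n} (a b x : Fin n) → 𝟙 (not (lookup (pair a b) x)) ≡ δᶜ b x * δᶜ a x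
  𝟙-∉-pair a b x rewrite lookup-◂ b (a ◂ ⊥) x | lookup-◂ a ⊥ x | lookup-replicate x outside
    with does (b ≟ x) | does (a ≟ x)
  ... | true  | _     = refl
  ... | false | true  = refl
  ... | false | false = refl

  ∉-◂ : ∀ {n} {x y : Fin n} {p} → x ≢ y → x ∉ p → x ∉ y ◂ p
  ∉-◂ {y = y} {p} x≢y x∉p x∈ with x∈p∪q⁻ ⁅ y ⁆ p x∈
  ... | inj₁ x∈⁅y⁆ = x≢y (x∈⁅y⁆⇒x≡y y x∈⁅y⁆)
  ... | inj₂ x∈p   = x∉p x∈p

  subsetSum-⊥ : ∀ {n} (w : Fin n → ℕ) → subsetSum ⊥ w ≡ 0
  subsetSum-⊥ w = ∑-zero (λ i → cong (λ b → 𝟙 b * w i) (lookup-replicate i outside))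

  ∣p∣≡∑lookup : ∀ {n} (p : Subset n) → ∣ p ∣ ≡ ∑[ i < n ] 𝟙 (lookup p i)
  ∣p∣≡∑lookup []            = refl
  ∣p∣≡∑lookup (inside ∷ p)  = cong suc (∣p∣≡∑lookup p)
  ∣p∣≡∑lookup (outside ∷ p) = ∣p∣≡∑lookup p

  subsetSum-◂ : ∀ {n} {x : Fin n} {p} → x ∉ p → ∀ w → subsetSum (x ◂ p) w ≡ w x + subsetSum p w
  subsetSum-◂ {n} {x} {p} x∉p w = begin
    subsetSum (x ◂ p) w                                        ≡⟨ sum-cong-≗ split ⟩
    ∑[ i < n ] (δ x i * w i + 𝟙 (lookup p i) * w i)            ≡⟨ ∑-distrib-+ (λ i → δ x i * w i) (λ i → 𝟙 (lookup p i) * w i) ⟩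
    ∑[ i < n ] (δ x i * w i) + subsetSum p w                   ≡⟨ cong (_+ subsetSum p w) (∑-δ x w) ⟩
    w x + subsetSum p w                                        ∎
    where
    open ≡-Reasoning
    split : ∀ i → 𝟙 (lookup (x ◂ p) i) * w i ≡ δ x i * w i + 𝟙 (lookup p i) * w i
    split i rewrite lookup-◂ x p i with x ≟ i
    ... | no _     = refl
    ... | yes refl with lookup p x in x∈p
    ...   | true  = contradiction (lookup⇒[]= x p x∈p) x∉p
    ...   | false = sym (+-identityʳ _)

  ∣x◂p∣≡1+∣p∣ : ∀ {n} {x : Fin n} {p} → x ∉ p → ∣ x ◂ p ∣ ≡ suc ∣ p ∣
  ∣x◂p∣≡1+∣p∣ {x = x} {p} x∉p = begin
    ∣ x ◂ p ∣                          ≡⟨ ∣p∣≡subsetSum (x ◂ p) ⟩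
    subsetSum (x ◂ p) (λ _ → 1)        ≡⟨ subsetSum-◂ x∉p (λ _ → 1) ⟩
    suc (subsetSum p (λ _ → 1))        ≡⟨ cong suc (∣p∣≡subsetSum p) ⟨
    suc ∣ p ∣                          ∎
    where
    open ≡-Reasoning
    ∣p∣≡subsetSum : ∀ q → ∣ q ∣ ≡ subsetSum q (λ _ → 1)
    ∣p∣≡subsetSum q = trans (∣p∣≡∑lookup q) (sum-cong-≗ (λ i → sym (*-identityʳ (𝟙 (lookup q i)))))

  ∣x◂p∣≤1+∣p∣ : ∀ {n} (x : Fin n) p → ∣ x ◂ p ∣ ≤ suc ∣ p ∣
  ∣x◂p∣≤1+∣p∣ {n} x p = begin
    ∣ x ◂ p ∣                                          ≡⟨ ∣p∣≡∑lookup (x ◂ p) ⟩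
    ∑[ i < n ] 𝟙 (lookup (x ◂ p) i)                    ≤⟨ ∑-mono-≤ (λ i → subst (λ b → 𝟙 b ≤ δ x i + 𝟙 (lookup p i)) (sym (lookup-◂ x p i)) (𝟙-∨ (does (x ≟ i)) (lookup p i))) ⟩
    ∑[ i < n ] (δ x i + 𝟙 (lookup p i))                ≡⟨ ∑-distrib-+ (δ x) (λ i → 𝟙 (lookup p i)) ⟩
    ∑[ i < n ] δ x i + ∑[ i < n ] 𝟙 (lookup p i)       ≡⟨ cong₂ _+_ (∑-δ-one x) (sym (∣p∣≡∑lookup p)) ⟩
    suc ∣ p ∣                                          ∎
    where
    open ≤-Reasoning

  ∣pair∣≤2 : ∀ {n} (a b : Fin n) → ∣ pair a b ∣ ≤ 2
  ∣pair∣≤2 {n} a b = ≤-trans (∣x◂p∣≤1+∣p∣ b (a ◂ ⊥)) (s≤s (≤-trans (∣x◂p∣≤1+∣p∣ a ⊥) (s≤s (≤-reflexive (∣⊥∣≡0 n)))))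

  ⊆-∣∣-antisym : ∀ {n} {t s : Subset n} → t ⊆ s → ∣ s ∣ ≤ ∣ t ∣ → t ≡ s
  ⊆-∣∣-antisym {t = t} {s} t⊆s ∣s∣≤∣t∣ = ⊆-antisym t⊆s s⊆t
    where
    s⊆t : s ⊆ t
    s⊆t {x} x∈s with x ∈? t
    ... | yes x∈t = x∈t
    ... | no  x∉t = contradiction ∣s∣≤∣t∣ (<⇒≱ (p⊂q⇒∣p∣<∣q∣ (t⊆s , x , x∈s , x∉t)))

  distinctMembers : ∀ {n} k (s : Subset n) → k ≤ ∣ s ∣ →
                    Σ[ φ ∈ (Fin k → Fin n) ] Injective _≡_ _≡_ φ × (∀ i → φ i ∈ s)
  distinctMembers k s k≤∣s∣ =
    let (φ , φ-inj , φ∈s) = distinctWitnesses k (lookup s) (subst (k ≤_) (∣p∣≡∑lookup s) k≤∣s∣)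
    in  φ , φ-inj , λ i → lookup⇒[]= (φ i) s (φ∈s i)

module Counting where

  open import Data.Nat using (ℕ; zero; suc; _+_; _*_; _≤_; _<_; _≡ᵇ_; _<ᵇ_; _!)
  open import Data.Nat.Properties
    using (+-identityʳ; *-identityˡ; *-identityʳ; *-zeroʳ; +-assoc; <⇒<ᵇ; ≤-trans; ≤-reflexive; *-mono-≤)
  open import Data.Nat.Tactic.RingSolver using (solve-∀)
  open import Data.Bool using (Bool; true; false; not; _∧_; T)
  open import Data.Empty using (⊥-elim)
  open import Data.Bool.Properties using (∧-zeroʳ)
  open import Data.Fin using (Fin; zero; suc)
  open import Data.Fin.Subset using (Subset; inside; outside; ⊥; _∪_; ∣_∣)
  open import Data.Fin.Subset.Properties using (∪-identityˡ)
  open import Data.Vec using ([]; _∷_; lookup)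
  open import Data.Vec.Properties using (lookup-replicate)
  open import Data.List using (List; []; _∷_; map; _++_; length; filterᵇ)
  open import Relation.Nullary using ()
  open import Relation.Binary.PropositionalEquality
  open import Defs using (allSubsets)
  open Indicators
  open Sums
  open Subsets

  length-filterᵇ-++ : ∀ {A : Set} (P : A → Bool) (xs ys : List A) →
    length (filterᵇ P (xs ++ ys)) ≡ length (filterᵇ P xs) + length (filterᵇ P ys)
  length-filterᵇ-++ P []       ys = refl
  length-filterᵇ-++ P (x ∷ xs) ys with P x
  ... | true  = cong suc (length-filterᵇ-++ P xs ys)
  ... | false = length-filterᵇ-++ P xs ys

  length-filterᵇ-map : ∀ {A B : Set} (P : B → Bool) (f : A → B) (xs : List A) →
    length (filterᵇ P (map f xs)) ≡ length (filterᵇ (λ x → P (f x)) xs)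
  length-filterᵇ-map P f []       = refl
  length-filterᵇ-map P f (x ∷ xs) with P (f x)
  ... | true  = cong suc (length-filterᵇ-map P f xs)
  ... | false = length-filterᵇ-map P f xs

  ∑ₛ : ∀ n → (Subset n → ℕ) → ℕ
  ∑ₛ zero    h = h []
  ∑ₛ (suc n) h = ∑ₛ n (λ s → h (outside ∷ s)) + ∑ₛ n (λ s → h (inside ∷ s))

  ∑ₛ-cong : ∀ n {g h : Subset n → ℕ} → (∀ s → g s ≡ h s) → ∑ₛ n g ≡ ∑ₛ n h
  ∑ₛ-cong zero    g≗h = g≗h []
  ∑ₛ-cong (suc n) g≗h = cong₂ _+_ (∑ₛ-cong n (λ s → g≗h _)) (∑ₛ-cong n (λ s → g≗h _))

  ∑ₛ-distrib-+ : ∀ n (g h : Subset n → ℕ) → ∑ₛ n (λ s → g s + h s) ≡ ∑ₛ n g + ∑ₛ n h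
  ∑ₛ-distrib-+ zero    g h = refl
  ∑ₛ-distrib-+ (suc n) g h = begin
    ∑ₛ n (λ s → g (outside ∷ s) + h (outside ∷ s)) + ∑ₛ n (λ s → g (inside ∷ s) + h (inside ∷ s))
      ≡⟨ cong₂ _+_ (∑ₛ-distrib-+ n _ _) (∑ₛ-distrib-+ n _ _) ⟩
    (gₒ + hₒ) + (gᵢ + hᵢ)
      ≡⟨ interchange gₒ hₒ gᵢ hᵢ ⟩
    (gₒ + gᵢ) + (hₒ + hᵢ)
      ∎
    where
    open ≡-Reasoning
    gₒ = ∑ₛ n (λ s → g (outside ∷ s))
    gᵢ = ∑ₛ n (λ s → g (inside ∷ s))
    hₒ = ∑ₛ n (λ s → h (outside ∷ s))
    hᵢ = ∑ₛ n (λ s → h (inside ∷ s))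
    interchange : ∀ a b c d → (a + b) + (c + d) ≡ (a + c) + (b + d)
    interchange = solve-∀

  ∑ₛ-zero : ∀ n (h : Subset n → ℕ) → (∀ s → h s ≡ 0) → ∑ₛ n h ≡ 0
  ∑ₛ-zero zero    h h≡0 = h≡0 []
  ∑ₛ-zero (suc n) h h≡0 = cong₂ _+_ (∑ₛ-zero n _ (λ s → h≡0 _)) (∑ₛ-zero n _ (λ s → h≡0 _))

  count : ∀ {n} → (Subset n → Bool) → ℕ
  count {n} P = ∑ₛ n (λ s → 𝟙 (P s))

  length-filterᵇ-allSubsets : ∀ n (P : Subset n → Bool) → length (filterᵇ P (allSubsets n)) ≡ count P
  length-filterᵇ-allSubsets zero P with P []
  ... | true  = refl
  ... | false = refl
  length-filterᵇ-allSubsets (suc n) P = begin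
    length (filterᵇ P (map (outside ∷_) (allSubsets n) ++ map (inside ∷_) (allSubsets n)))
      ≡⟨ length-filterᵇ-++ P (map (outside ∷_) (allSubsets n)) (map (inside ∷_) (allSubsets n)) ⟩
    length (filterᵇ P (map (outside ∷_) (allSubsets n))) + length (filterᵇ P (map (inside ∷_) (allSubsets n)))
      ≡⟨ cong₂ _+_ (trans (length-filterᵇ-map P (outside ∷_) (allSubsets n)) (length-filterᵇ-allSubsets n _))
                   (trans (length-filterᵇ-map P (inside ∷_) (allSubsets n)) (length-filterᵇ-allSubsets n _)) ⟩
    count P
      ∎
    where open ≡-Reasoning

  countOfSize : ∀ {n} → ℕ → (Subset n → Bool) → ℕ
  countOfSize k P = count (λ s → P s ∧ (∣ s ∣ ≡ᵇ k))

  countBelow : ∀ {n} → ℕ → (Subset n → Bool) → ℕ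
  countBelow zero    P = 0
  countBelow (suc m) P = countOfSize m P + countBelow m P

  count≡countBelow : ∀ {n} m (P : Subset n → Bool) → (∀ s → P s ≡ true → ∣ s ∣ < m) → count P ≡ countBelow m P
  count≡countBelow {n} m P small = trans (∑ₛ-cong n (λ s → cong 𝟙 (sym (restrict s)))) (countUnder≡countBelow m)
    where
    restrict : ∀ s → P s ∧ (∣ s ∣ <ᵇ m) ≡ P s
    restrict s with P s in Ps | ∣ s ∣ <ᵇ m in lt
    ... | false | _     = refl
    ... | true  | true  = refl
    ... | true  | false = ⊥-elim (subst T lt (<⇒<ᵇ (small s Ps)))
    split : ∀ b x m → 𝟙 (b ∧ (x <ᵇ suc m)) ≡ 𝟙 (b ∧ (x ≡ᵇ m)) + 𝟙 (b ∧ (x <ᵇ m))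
    split false x       m       = refl
    split true  zero    zero    = refl
    split true  zero    (suc m) = refl
    split true  (suc x) zero    = refl
    split true  (suc x) (suc m) = split true x m
    countUnder≡countBelow : ∀ m → count (λ s → P s ∧ (∣ s ∣ <ᵇ m)) ≡ countBelow m P
    countUnder≡countBelow zero    = ∑ₛ-zero n _ (λ s → cong 𝟙 (∧-zeroʳ (P s)))
    countUnder≡countBelow (suc m) = begin
      count (λ s → P s ∧ (∣ s ∣ <ᵇ suc m))
        ≡⟨ ∑ₛ-cong n (λ s → split (P s) ∣ s ∣ m) ⟩
      ∑ₛ n (λ s → 𝟙 (P s ∧ (∣ s ∣ ≡ᵇ m)) + 𝟙 (P s ∧ (∣ s ∣ <ᵇ m)))
        ≡⟨ ∑ₛ-distrib-+ n _ _ ⟩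
      countOfSize m P + count (λ s → P s ∧ (∣ s ∣ <ᵇ m))
        ≡⟨ cong (countOfSize m P +_) (countUnder≡countBelow m) ⟩
      countBelow (suc m) P
        ∎
      where open ≡-Reasoning

  tuples : ∀ {n} → ℕ → (Subset n → Bool) → Subset n → ℕ
  tuples     zero    Q A = 𝟙 (Q A)
  tuples {n} (suc k) Q A = ∑[ x < n ] (𝟙 (not (lookup A x)) * tuples k Q (x ◂ A))

  module _ {n : ℕ} (Q : Subset (suc n) → Bool) where

    private
      Qᵢ Qₒ : Subset n → Bool
      Qᵢ s = Q (inside ∷ s)
      Qₒ s = Q (outside ∷ s)

    tuples-inside : ∀ k A → tuples k Q (inside ∷ A) ≡ tuples k Qᵢ A
    tuples-inside zero    A = refl
    tuples-inside (suc k) A = sum-cong-≗ (λ x → cong (𝟙 (not (lookup A x)) *_) (tuples-inside k (x ◂ A)))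

    tuples-outside : ∀ k A → tuples (suc k) Q (outside ∷ A) ≡ suc k * tuples k Qᵢ A + tuples (suc k) Qₒ A
    tuples-outside zero    A = cong (λ B → 𝟙 (Q (inside ∷ B)) + 0 + tuples 1 Qₒ A) (∪-identityˡ A)
    tuples-outside (suc k) A = begin
      1 * tuples (suc k) Q (inside ∷ (⊥ ∪ A)) + ∑[ x < n ] (𝟙 (not (lookup A x)) * tuples (suc k) Q (outside ∷ (x ◂ A)))
        ≡⟨ cong₂ _+_ (trans (+-identityʳ _) (trans (cong (λ B → tuples (suc k) Q (inside ∷ B)) (∪-identityˡ A)) (tuples-inside (suc k) A)))
                     (sum-cong-≗ (λ x → cong (𝟙 (not (lookup A x)) *_) (tuples-outside k (x ◂ A)))) ⟩
      tᵢ + ∑[ x < n ] (𝟙 (not (lookup A x)) * (suc k * tuples k Qᵢ (x ◂ A) + tuples (suc k) Qₒ (x ◂ A)))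
        ≡⟨ cong (tᵢ +_) (trans (sum-cong-≗ (λ x → distrib (𝟙 (not (lookup A x))) (suc k) _ _))
                               (trans (∑-distrib-+ (λ x → suc k * (𝟙ₓ x * tuples k Qᵢ (x ◂ A))) (λ x → 𝟙ₓ x * tuples (suc k) Qₒ (x ◂ A)))
                                      (cong (_+ tuples (suc (suc k)) Qₒ A) (sym (*-distribˡ-sum (suc k) (λ x → 𝟙ₓ x * tuples k Qᵢ (x ◂ A))))))) ⟩
      tᵢ + (suc k * tᵢ + tuples (suc (suc k)) Qₒ A)
        ≡⟨ +-assoc tᵢ _ _ ⟨
      suc (suc k) * tᵢ + tuples (suc (suc k)) Qₒ A
        ∎
      where
      open ≡-Reasoning
      tᵢ = tuples (suc k) Qᵢ A
      𝟙ₓ : Fin n → ℕ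
      𝟙ₓ x = 𝟙 (not (lookup A x))
      distrib : ∀ a c x y → a * (c * x + y) ≡ c * (a * x) + a * y
      distrib = solve-∀

  tuples-⊥ : ∀ {n} k (Q : Subset n → Bool) → tuples k Q ⊥ ≡ k ! * countOfSize k Q
  tuples-⊥ {zero}  zero    Q with Q []
  ... | true  = refl
  ... | false = refl
  tuples-⊥ {zero}  (suc k) Q = trans (sym (*-zeroʳ (suc k !))) (cong (λ b → suc k ! * 𝟙 b) (sym (∧-zeroʳ (Q []))))
  tuples-⊥ {suc n} zero    Q = begin
    tuples 0 (λ s → Q (outside ∷ s)) ⊥                                   ≡⟨ tuples-⊥ zero (λ s → Q (outside ∷ s)) ⟩
    1 * countOfSize 0 (λ s → Q (outside ∷ s))                            ≡⟨ cong (1 *_) (+-identityʳ _) ⟨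
    1 * (countOfSize 0 (λ s → Q (outside ∷ s)) + 0)                      ≡⟨ cong (λ c → 1 * (countOfSize 0 (λ s → Q (outside ∷ s)) + c))
                                                                              (∑ₛ-zero n _ (λ s → cong 𝟙 (∧-zeroʳ _))) ⟨
    1 * countOfSize 0 Q                                                  ∎
    where open ≡-Reasoning
  tuples-⊥ {suc n} (suc k) Q = begin
    tuples (suc k) Q (outside ∷ ⊥)                                       ≡⟨ tuples-outside Q k ⊥ ⟩
    suc k * tuples k Qᵢ ⊥ + tuples (suc k) Qₒ ⊥                         ≡⟨ cong₂ (λ a b → suc k * a + b) (tuples-⊥ k Qᵢ) (tuples-⊥ (suc k) Qₒ) ⟩
    suc k * (k ! * countOfSize k Qᵢ) + suc k ! * countOfSize (suc k) Qₒ ≡⟨ collect (suc k) (k !) _ _ ⟩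
    suc k ! * (countOfSize (suc k) Qₒ + countOfSize k Qᵢ)                ∎
    where
    open ≡-Reasoning
    Qᵢ Qₒ : Subset n → Bool
    Qᵢ s = Q (inside ∷ s)
    Qₒ s = Q (outside ∷ s)
    collect : ∀ a f x y → a * (f * x) + (a * f) * y ≡ (a * f) * (y + x)
    collect = solve-∀

  countOfSize₀≤1 : ∀ {n} (P : Subset n → Bool) → countOfSize 0 P ≤ 1
  countOfSize₀≤1 P = subst (_≤ 1) (trans (tuples-⊥ 0 P) (*-identityˡ _)) (𝟙≤1 (P ⊥))

  countOfSize₁≤n : ∀ {n} (P : Subset n → Bool) → countOfSize 1 P ≤ n
  countOfSize₁≤n {n} P = subst (_≤ n) (trans (tuples-⊥ 1 P) (*-identityˡ _))
    (≤-trans (∑-≤-const 1 (λ x → *-mono-≤ (𝟙≤1 (not (lookup ⊥ x))) (𝟙≤1 (P (x ◂ ⊥))))) (≤-reflexive (*-identityʳ n)))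

  tuples-one : ∀ {n} (Q : Subset n → Bool) A → tuples 1 Q A ≡ ∑[ x < n ] 𝟙 (not (lookup A x) ∧ Q (x ◂ A))
  tuples-one Q A = sum-cong-≗ (λ x → sym (𝟙-∧ (not (lookup A x)) (Q (x ◂ A))))

  ∑²-pairs-tuples : ∀ {n} k (Q : Subset n → Bool) → ∑² (λ a b → δᶜ a b * tuples k Q (pair a b)) ≡ tuples (2 + k) Q ⊥
  ∑²-pairs-tuples {n} k Q = sym (sum-cong-≗ pairs)
    where
    pairs : ∀ a → 𝟙 (not (lookup ⊥ a)) * ∑[ b < n ] (𝟙 (not (lookup (a ◂ ⊥) b)) * tuples k Q (b ◂ a ◂ ⊥))
                ≡ ∑[ b < n ] (δᶜ a b * tuples k Q (pair a b))
    pairs a rewrite lookup-replicate a outside =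
      trans (+-identityʳ _) (sum-cong-≗ (λ b → cong (λ x → 𝟙 (not x) * tuples k Q (pair a b)) (lookup-◂⊥ a b)))

module Complexes where

  open import Data.Nat using (ℕ; zero; suc; _≤_)
  open import Data.Bool using (true)
  open import Data.Fin using (Fin; zero; suc)
  open import Data.Fin.Subset using (Subset; inside; outside; ⊥; ⁅_⁆; _⊆_; _∈_; ∣_∣)
  open import Data.Fin.Subset.Properties using (x∈p∪q⁻; x∈p∪q⁺; x∈⁅x⁆; x∈⁅y⁆⇒x≡y; ∉⊥)
  open import Data.Vec using ([]; _∷_; here; there; lookup)
  open import Data.Vec.Relation.Unary.All using ([]; _∷_)
  open import Data.Vec.Relation.Unary.Unique.Propositional using (Unique; []; _∷_)
  open import Data.Vec.Relation.Unary.Unique.Propositional.Properties using (lookup-injective)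
  open import Data.List.Relation.Unary.Any using (here; there)
  open import Data.List.Membership.Propositional using () renaming (_∈_ to _∈ᴸ_)
  open import Data.Product using (Σ-syntax; _×_; _,_)
  open import Data.Sum using (inj₁; inj₂)
  open import Data.Empty using (⊥-elim)
  open import Function using (_∘_)
  open import Function.Definitions using (Injective)
  open import Relation.Binary.PropositionalEquality
  open import Defs using (Complex; edge; downward; image; generatorsF; ContainsF)
  open Subsets

  face : ∀ {n} (H : Complex n) {p q : Subset n} → p ⊆ q → edge H q ≡ true → edge H p ≡ true
  face H p⊆q = downward H _ _ p⊆q

  ∈-image⁻ : ∀ {m n} (φ : Fin m → Fin n) e {x} → x ∈ image φ e → Σ[ i ∈ Fin m ] i ∈ e × φ i ≡ x
  ∈-image⁻ φ []            x∈ = ⊥-elim (∉⊥ x∈)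
  ∈-image⁻ φ (outside ∷ e) x∈ = let (i , i∈e , φi≡x) = ∈-image⁻ (φ ∘ suc) e x∈ in suc i , there i∈e , φi≡x
  ∈-image⁻ φ (inside ∷ e)  x∈ with x∈p∪q⁻ ⁅ φ zero ⁆ (image (φ ∘ suc) e) x∈
  ... | inj₁ x∈⁅φ₀⁆ = zero , here , sym (x∈⁅y⁆⇒x≡y (φ zero) x∈⁅φ₀⁆)
  ... | inj₂ x∈img  = let (i , i∈e , φi≡x) = ∈-image⁻ (φ ∘ suc) e x∈img in suc i , there i∈e , φi≡x

  ∈-image⁺ : ∀ {m n} (φ : Fin m → Fin n) {e i} → i ∈ e → φ i ∈ image φ e
  ∈-image⁺ φ               here        = x∈p∪q⁺ (inj₁ (x∈⁅x⁆ (φ zero)))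
  ∈-image⁺ φ {inside ∷ e}  (there i∈e) = x∈p∪q⁺ (inj₂ (∈-image⁺ (φ ∘ suc) i∈e))
  ∈-image⁺ φ {outside ∷ e} (there i∈e) = ∈-image⁺ (φ ∘ suc) i∈e

  image-mono : ∀ {m n} (φ : Fin m → Fin n) {e g} → e ⊆ g → image φ e ⊆ image φ g
  image-mono φ {e} e⊆g x∈ with ∈-image⁻ φ e x∈
  ... | i , i∈e , refl = ∈-image⁺ φ (e⊆g i∈e)

  image-⊆ : ∀ {m n} (φ : Fin m → Fin n) {s} → (∀ i → φ i ∈ s) → ∀ e → image φ e ⊆ s
  image-⊆ φ φ∈s e x∈ with ∈-image⁻ φ e x∈
  ... | i , _ , refl = φ∈s i

  module _ {n : ℕ} (H : Complex n) where

    containsF : (φ : Fin 5 → Fin n) → Injective _≡_ _≡_ φ →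
                (∀ g → g ∈ᴸ generatorsF → edge H (image φ g) ≡ true) → ContainsF H
    containsF φ φ-inj generators = φ , φ-inj , λ { e (g , g∈ , e⊆g) → face H (image-mono φ e⊆g) (generators g g∈) }

    containsF-of-faces : ∀ v₁ v₂ v₃ v₄ v₅ → Unique (v₁ ∷ v₂ ∷ v₃ ∷ v₄ ∷ v₅ ∷ []) →
                         edge H (v₁ ◂ v₂ ◂ v₃ ◂ ⊥) ≡ true → edge H (v₂ ◂ v₃ ◂ v₄ ◂ ⊥) ≡ true →
                         edge H (v₂ ◂ v₅ ◂ ⊥) ≡ true → edge H (v₃ ◂ v₅ ◂ ⊥) ≡ true → ContainsF H
    containsF-of-faces v₁ v₂ v₃ v₄ v₅ distinct e₁₂₃ e₂₃₄ e₂₅ e₃₅ =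
      containsF (lookup vs) (λ {i} {j} → lookup-injective distinct i j) generators
      where
      vs = v₁ ∷ v₂ ∷ v₃ ∷ v₄ ∷ v₅ ∷ []
      generators : ∀ g → g ∈ᴸ generatorsF → edge H (image (lookup vs) g) ≡ true
      generators _ (here refl)                         = e₁₂₃
      generators _ (there (here refl))                 = e₂₃₄
      generators _ (there (there (here refl)))         = e₂₅
      generators _ (there (there (there (here refl)))) = e₃₅

    containsF-of-large-edge : ∀ {s} → edge H s ≡ true → 5 ≤ ∣ s ∣ → ContainsF H
    containsF-of-large-edge {s} e 5≤∣s∣ =
      let (φ , φ-inj , φ∈s) = distinctMembers 5 s 5≤∣s∣
      in  containsF φ φ-inj (λ g _ → face H (image-⊆ φ φ∈s g) e)

    containsF-of-book : ∀ {a b l₁ l₂ c} → Unique (l₁ ∷ a ∷ b ∷ l₂ ∷ c ∷ []) →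
                        edge H (l₁ ◂ pair a b) ≡ true → edge H (l₂ ◂ pair a b) ≡ true →
                        edge H (pair a c) ≡ true → edge H (pair b c) ≡ true → ContainsF H
    containsF-of-book {a} {b} {l₁} {l₂} {c} distinct abl₁ abl₂ ac bc =
      containsF-of-faces l₁ a b l₂ c distinct
        (reorder (cong (l₁ ◂_) (pair-comm a b)) abl₁)
        (reorder (trans (cong (l₂ ◂_) (pair-comm a b)) (trans (◂-swap l₂ a (b ◂ ⊥)) (cong (a ◂_) (◂-swap l₂ b ⊥)))) abl₂)
        (reorder (pair-comm a c) ac)
        (reorder (pair-comm b c) bc)
      where
      reorder : ∀ {p q} → p ≡ q → edge H p ≡ true → edge H q ≡ true
      reorder = subst (λ p → edge H p ≡ true)

module Weights where

  open import Data.Nat using (ℕ; zero; suc; _+_; _*_; _∸_; _≤_; z≤n; s≤s; _≤?_)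
  open import Data.Nat.Properties
    using (≤-refl; ≤-reflexive; ≤-trans; ≤-pred; ≰⇒>; ≤ᵇ⇒≤; n≤0⇒n≡0; +-identityʳ; *-zeroʳ; m+n∸n≡m;
           +-mono-≤; +-monoˡ-≤; +-monoʳ-≤; *-monoʳ-≤; module ≤-Reasoning)
  open import Data.Nat.Tactic.RingSolver using (solve-∀)
  open import Data.Bool using (Bool; true; false; not; _∧_)
  import Data.Bool.Properties as Bool
  open import Data.Bool.Properties using (¬-not)
  open import Data.Fin using (Fin; zero; suc)
  open import Data.Fin.Properties using (_≟_)
  open import Data.Fin.Subset using (⊥)
  open import Data.Fin.Subset.Properties using (⊆-min)
  open import Data.Vec using (lookup; _∷_; [])
  open import Data.Vec.Relation.Unary.All using ([]; _∷_)
  open import Data.Vec.Relation.Unary.Unique.Propositional using ([]; _∷_)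
  open import Data.Product using (Σ-syntax; _×_; _,_)
  open import Data.Empty using (⊥-elim) renaming (⊥ to ⊥-Empty)
  open import Data.Sum as Sum using (_⊎_; inj₁; inj₂)
  open import Function.Definitions using (Injective)
  open import Relation.Nullary using (¬_; does; yes; no; contradiction)
  open import Relation.Binary.PropositionalEquality
  open import Defs using (Complex; edge; ContainsF)
  open Indicators
  open Sums
  open Subsets
  open Counting
  open Complexes

  module _ {n : ℕ} (H : Complex n) where

    tuples₁-of-nonEdge : ∀ {p} → edge H p ≡ false → tuples 1 (edge H) p ≡ 0
    tuples₁-of-nonEdge {p} ¬p = ∑-zero term
      where
      term : ∀ x → 𝟙 (not (lookup p x)) * 𝟙 (edge H (x ◂ p)) ≡ 0
      term x with edge H (x ◂ p) in x◂p
      ... | false = *-zeroʳ (𝟙 (not (lookup p x)))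
      ... | true  = contradiction (trans (sym (face H (p⊆x◂p x p) x◂p)) ¬p) (λ ())

    tuples₂≤ : ∀ p → tuples 2 (edge H) p ≤ tuples 1 (edge H) p * (tuples 1 (edge H) p ∸ 1)
    tuples₂≤ p = begin
      tuples 2 (edge H) p                  ≤⟨ ∑-mono-≤ perApex ⟩
      ∑[ x < n ] (τ x * (t ∸ 1))           ≡⟨ *-distribʳ-sum (t ∸ 1) τ ⟨
      ∑[ x < n ] τ x * (t ∸ 1)             ≡⟨ cong (_* (t ∸ 1)) (tuples-one (edge H) p) ⟨
      t * (t ∸ 1)                          ∎
      where
      open ≤-Reasoning
      τ : Fin n → ℕ
      τ x = 𝟙 (not (lookup p x) ∧ edge H (x ◂ p))
      t = tuples 1 (edge H) p
      S : Fin n → ℕ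
      S x = tuples 1 (edge H) (x ◂ p)
      S≤ : ∀ x → S x ≤ ∑[ y < n ] (δᶜ x y * τ y)
      S≤ x = ∑-mono-≤ term
        where
        term : ∀ y → 𝟙 (not (lookup (x ◂ p) y)) * 𝟙 (edge H (y ◂ x ◂ p)) ≤ δᶜ x y * τ y
        term y rewrite lookup-◂ x p y with does (x ≟ y) | lookup p y | edge H (y ◂ x ◂ p) in y◂x◂p
        ... | true  | _     | _     = z≤n
        ... | false | true  | _     = z≤n
        ... | false | false | false = z≤n
        ... | false | false | true  rewrite face H (◂-mono y (p⊆x◂p x p)) y◂x◂p = ≤-refl
      perApex : ∀ x → 𝟙 (not (lookup p x)) * S x ≤ τ x * (t ∸ 1)
      perApex x with lookup p x in p∌x | edge H (x ◂ p) in x◂p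
      ... | true  | _     = z≤n
      ... | false | false = ≤-reflexive (trans (+-identityʳ (S x)) (tuples₁-of-nonEdge x◂p))
      ... | false | true  = begin
        S x + 0                          ≡⟨ +-identityʳ (S x) ⟩
        S x                              ≤⟨ S≤ x ⟩
        ∑[ y < n ] (δᶜ x y * τ y)        ≡⟨ m+n∸n≡m _ 1 ⟨
        ∑[ y < n ] (δᶜ x y * τ y) + 1 ∸ 1 ≡⟨ cong (_∸ 1) (trans (cong (∑[ y < n ] (δᶜ x y * τ y) +_) (sym τx≡1)) (∑-δᶜ x τ)) ⟩
        sum τ ∸ 1                        ≡⟨ cong (_∸ 1) (tuples-one (edge H) p) ⟨
        t ∸ 1                            ≡⟨ +-identityʳ (t ∸ 1) ⟨
        t ∸ 1 + 0                        ∎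
        where
        τx≡1 : τ x ≡ 1
        τx≡1 rewrite p∌x | x◂p = refl

    -- Each edge with k = 2, 3, 4 vertices contributes 24 to the sum of the weights over ordered pairs.
    triangles tetrahedra weight : Fin n → Fin n → ℕ
    triangles  a b = tuples 1 (edge H) (pair a b)
    tetrahedra a b = tuples 2 (edge H) (pair a b)
    weight     a b = 12 * 𝟙 (edge H (pair a b)) + 4 * triangles a b + tetrahedra a b

    triangle-rotate : ∀ a b c → edge H (c ◂ pair a b) ≡ edge H (a ◂ pair b c)
    triangle-rotate a b c = cong (edge H) (trans (cong (c ◂_) (◂-swap b a ⊥)) (◂-swap c a (b ◂ ⊥)))

    triangle-swap : ∀ a b c → edge H (c ◂ pair a b) ≡ edge H (b ◂ pair a c)
    triangle-swap a b c = cong (edge H) (◂-swap c b (a ◂ ⊥))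

    weight-sym : ∀ a b → weight a b ≡ weight b a
    weight-sym a b = cong (λ p → 12 * tuples 0 (edge H) p + 4 * tuples 1 (edge H) p + tuples 2 (edge H) p) (pair-comm a b)

    ∑²-weight : ∑² (λ a b → δᶜ a b * weight a b)
                ≡ 24 * (countOfSize 2 (edge H) + countOfSize 3 (edge H) + countOfSize 4 (edge H))
    ∑²-weight = begin
      ∑² (λ a b → δᶜ a b * weight a b)
        ≡⟨ ∑²-cong (λ a b → distrib (δᶜ a b) (tuples 0 (edge H) (pair a b)) (triangles a b) (tetrahedra a b)) ⟩
      ∑² (λ a b → 12 * P 0 a b + 4 * P 1 a b + P 2 a b)
        ≡⟨ ∑²-distrib-+ (λ a b → 12 * P 0 a b + 4 * P 1 a b) (P 2) ⟩
      ∑² (λ a b → 12 * P 0 a b + 4 * P 1 a b) + ∑² (P 2)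
        ≡⟨ cong (_+ ∑² (P 2)) (trans (∑²-distrib-+ (λ a b → 12 * P 0 a b) (λ a b → 4 * P 1 a b))
                                     (cong₂ _+_ (∑²-distribˡ 12 (P 0)) (∑²-distribˡ 4 (P 1)))) ⟩
      12 * ∑² (P 0) + 4 * ∑² (P 1) + ∑² (P 2)
        ≡⟨ cong₂ (λ x y → 12 * x + 4 * y + ∑² (P 2)) (∑²-pairs-tuples 0 (edge H)) (∑²-pairs-tuples 1 (edge H)) ⟩
      12 * tuples 2 (edge H) ⊥ + 4 * tuples 3 (edge H) ⊥ + ∑² (P 2)
        ≡⟨ cong (12 * tuples 2 (edge H) ⊥ + 4 * tuples 3 (edge H) ⊥ +_) (∑²-pairs-tuples 2 (edge H)) ⟩
      12 * tuples 2 (edge H) ⊥ + 4 * tuples 3 (edge H) ⊥ + tuples 4 (edge H) ⊥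
        ≡⟨ cong₂ (λ x y → 12 * x + 4 * y + tuples 4 (edge H) ⊥) (tuples-⊥ 2 (edge H)) (tuples-⊥ 3 (edge H)) ⟩
      12 * (2 * c₂) + 4 * (6 * c₃) + tuples 4 (edge H) ⊥
        ≡⟨ cong (12 * (2 * c₂) + 4 * (6 * c₃) +_) (tuples-⊥ 4 (edge H)) ⟩
      12 * (2 * c₂) + 4 * (6 * c₃) + 24 * c₄
        ≡⟨ collect c₂ c₃ c₄ ⟩
      24 * (c₂ + c₃ + c₄)
        ∎
      where
      open ≡-Reasoning
      P : ℕ → Fin n → Fin n → ℕ
      P k a b = δᶜ a b * tuples k (edge H) (pair a b)
      c₂ = countOfSize 2 (edge H)
      c₃ = countOfSize 3 (edge H)
      c₄ = countOfSize 4 (edge H)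
      distrib : ∀ d x y z → d * (12 * x + 4 * y + z) ≡ 12 * (d * x) + 4 * (d * y) + d * z
      distrib = solve-∀
      collect : ∀ x y z → 12 * (2 * x) + 4 * (6 * y) + 24 * z ≡ 24 * (x + y + z)
      collect = solve-∀

    ∑³-triangles : ∑³ (λ i j k → δ₃ i j k * 𝟙 (edge H (k ◂ pair i j))) ≡ ∑² (λ i j → δᶜ i j * triangles i j)
    ∑³-triangles = ∑²-cong (λ i j → trans (sum-cong-≗ (λ k → term i j k)) (sym (*-distribˡ-sum (δᶜ i j) (λ k → 𝟙 (not (lookup (pair i j) k)) * 𝟙 (edge H (k ◂ pair i j))))))
      where
      term : ∀ i j k → δ₃ i j k * 𝟙 (edge H (k ◂ pair i j))
                       ≡ δᶜ i j * (𝟙 (not (lookup (pair i j) k)) * 𝟙 (edge H (k ◂ pair i j)))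
      term i j k rewrite 𝟙-∉-pair i j k = reorder (δᶜ i j) (δᶜ i k) (δᶜ j k) _
        where
        reorder : ∀ a b c x → a * (b * c) * x ≡ a * (c * b * x)
        reorder = solve-∀

    apexes : ∀ k {a b} → k ≤ triangles a b →
             Σ[ φ ∈ (Fin k → Fin n) ] Injective _≡_ _≡_ φ × (∀ i → φ i ≢ a × φ i ≢ b × edge H (φ i ◂ pair a b) ≡ true)
    apexes k {a} {b} k≤t =
      let (φ , φ-inj , φ-apex) = distinctWitnesses k (λ x → not (lookup (pair a b) x) ∧ edge H (x ◂ pair a b))
                                                     (subst (k ≤_) (tuples-one (edge H) (pair a b)) k≤t)
      in  φ , φ-inj , λ i → apex (φ i) (∧-true (φ-apex i))
      where
      apex : ∀ x → not (lookup (pair a b) x) ≡ true × edge H (x ◂ pair a b) ≡ true →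
             x ≢ a × x ≢ b × edge H (x ◂ pair a b) ≡ true
      apex x (x∉ab , abx) = let (x≢a , x≢b) = lookup-pair≡false (not-true x∉ab) in x≢a , x≢b , abx

    weight≤ : ∀ {a b} → a ≢ b → weight a b ≤ 12 + 4 * triangles a b + triangles a b * (triangles a b ∸ 1)
    weight≤ {a} {b} a≢b =
      +-mono-≤ (+-monoˡ-≤ (4 * triangles a b) (*-monoʳ-≤ 12 (𝟙≤1 (edge H (pair a b))))) (tuples₂≤ (pair a b))

    weight-of-nonEdge : ∀ {a b} → edge H (pair a b) ≡ false → weight a b ≡ 0
    weight-of-nonEdge {a} {b} ¬ab rewrite ¬ab | tuples₁-of-nonEdge ¬ab = n≤0⇒n≡0 (subst (tetrahedra a b ≤_) t*t∸1≡0 (tuples₂≤ (pair a b)))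
      where
      t*t∸1≡0 : triangles a b * (triangles a b ∸ 1) ≡ 0
      t*t∸1≡0 rewrite tuples₁-of-nonEdge ¬ab = refl

    module _ (F-free : ¬ ContainsF H) where

      triangles≤2 : ∀ {a b} → a ≢ b → triangles a b ≤ 2
      triangles≤2 {a} {b} a≢b with 3 ≤? triangles a b
      ... | no  3≰t = ≤-pred (≰⇒> 3≰t)
      ... | yes 3≤t =
        let (φ , φ-inj , φ-apex) = apexes 3 3≤t
            (l₁≢a , l₁≢b , abl₁) = φ-apex zero
            (l₂≢a , l₂≢b , abl₂) = φ-apex (suc zero)
            (c≢a , c≢b , abc)    = φ-apex (suc (suc zero))
            φ≢ = injective⇒≢ φ-inj
        in  contradiction
              (containsF-of-book H
                ((l₁≢a ∷ l₁≢b ∷ φ≢ (λ ()) ∷ φ≢ (λ ()) ∷ []) ∷ (a≢b ∷ ≢-sym l₂≢a ∷ ≢-sym c≢a ∷ [])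
                   ∷ (≢-sym l₂≢b ∷ ≢-sym c≢b ∷ []) ∷ (φ≢ (λ ()) ∷ []) ∷ [] ∷ [])
                abl₁ abl₂
                (face H (◂-mono _ (p⊆x◂p b (a ◂ ⊥))) abc)
                (face H (◂-mono _ (◂-mono b (⊆-min (a ◂ ⊥)))) abc))
              F-free

      no-book : ∀ {a b c} → a ≢ b → c ≢ a → c ≢ b → edge H (c ◂ pair a b) ≡ false → 2 ≤ triangles a b →
               edge H (pair a c) ≡ true → edge H (pair b c) ≡ true → ⊥-Empty
      no-book {a} {b} {c} a≢b c≢a c≢b abc 2≤t ac bc =
        let (φ , φ-inj , φ-apex) = apexes 2 2≤t
            (l₁≢a , l₁≢b , abl₁) = φ-apex zero
            (l₂≢a , l₂≢b , abl₂) = φ-apex (suc zero)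
        in  F-free (containsF-of-book H
              ((l₁≢a ∷ l₁≢b ∷ injective⇒≢ φ-inj (λ ()) ∷ l≢c abl₁ ∷ [])
                 ∷ (a≢b ∷ ≢-sym l₂≢a ∷ ≢-sym c≢a ∷ []) ∷ (≢-sym l₂≢b ∷ ≢-sym c≢b ∷ []) ∷ (l≢c abl₂ ∷ []) ∷ [] ∷ [])
              abl₁ abl₂ ac bc)
        where
        l≢c : ∀ {l} → edge H (l ◂ pair a b) ≡ true → l ≢ c
        l≢c abl refl with () ← trans (sym abl) abc

      weight≤22 : ∀ {a b} → a ≢ b → weight a b ≤ 22
      weight≤22 {a} {b} a≢b = ≤-trans (weight≤ a≢b) (bound (triangles a b) (triangles≤2 a≢b))
        where
        bound : ∀ x → x ≤ 2 → 12 + 4 * x + x * (x ∸ 1) ≤ 22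
        bound 0 _ = ≤ᵇ⇒≤ 12 22 _
        bound 1 _ = ≤ᵇ⇒≤ 16 22 _
        bound 2 _ = ≤-refl
        bound (suc (suc (suc _))) (s≤s (s≤s ()))

      weight≤16 : ∀ {a b} → a ≢ b → triangles a b ≤ 1 → weight a b ≤ 16
      weight≤16 {a} {b} a≢b t≤1 = ≤-trans (weight≤ a≢b) (bound (triangles a b) t≤1)
        where
        bound : ∀ x → x ≤ 1 → 12 + 4 * x + x * (x ∸ 1) ≤ 16
        bound 0 _ = ≤ᵇ⇒≤ 12 16 _
        bound 1 _ = ≤-refl
        bound (suc (suc _)) (s≤s ())

      noTriangle⇒weight≡0 : ∀ {a b c} → a ≢ b → c ≢ a → c ≢ b → edge H (c ◂ pair a b) ≡ false →
                            2 ≤ triangles a b → weight a c ≡ 0 ⊎ weight b c ≡ 0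
      noTriangle⇒weight≡0 {a} {b} {c} a≢b c≢a c≢b abc 2≤t with edge H (pair a c) Bool.≟ true | edge H (pair b c) Bool.≟ true
      ... | no ¬ac | _      = inj₁ (weight-of-nonEdge (¬-not ¬ac))
      ... | yes _  | no ¬bc = inj₂ (weight-of-nonEdge (¬-not ¬bc))
      ... | yes ac | yes bc = ⊥-elim (no-book a≢b c≢a c≢b abc 2≤t ac bc)

      triple-weights≤48-of-vanishing : ∀ {i j k} → i ≢ j → j ≢ k → i ≢ k →
                                weight i j ≡ 0 ⊎ weight j k ≡ 0 ⊎ weight i k ≡ 0 → weight i j + weight j k + weight i k ≤ 48
      triple-weights≤48-of-vanishing {i} {j} {k} i≢j j≢k i≢k vanishing = ≤-trans (≤44 vanishing) (≤ᵇ⇒≤ 44 48 _)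
        where
        ≤44 : weight i j ≡ 0 ⊎ weight j k ≡ 0 ⊎ weight i k ≡ 0 → weight i j + weight j k + weight i k ≤ 44
        ≤44 (inj₁ ij≡0)        rewrite ij≡0 = +-mono-≤ (weight≤22 j≢k) (weight≤22 i≢k)
        ≤44 (inj₂ (inj₁ jk≡0)) rewrite jk≡0 = +-mono-≤ (≤-trans (≤-reflexive (+-identityʳ (weight i j))) (weight≤22 i≢j)) (weight≤22 i≢k)
        ≤44 (inj₂ (inj₂ ik≡0)) rewrite ik≡0 = ≤-trans (≤-reflexive (+-identityʳ (weight i j + weight j k))) (+-mono-≤ (weight≤22 i≢j) (weight≤22 j≢k))

      triple-weights≤48 : ∀ {i j k} → i ≢ j → j ≢ k → i ≢ k → edge H (k ◂ pair i j) ≡ false →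
                   weight i j + weight j k + weight i k ≤ 48
      triple-weights≤48 {i} {j} {k} i≢j j≢k i≢k ijk with 2 ≤? triangles i j | 2 ≤? triangles j k | 2 ≤? triangles i k
      ... | yes 2≤t | _       | _       = triple-weights≤48-of-vanishing i≢j j≢k i≢k
        (Sum.[ (λ ik≡0 → inj₂ (inj₂ ik≡0)) , (λ jk≡0 → inj₂ (inj₁ jk≡0)) ]
          (noTriangle⇒weight≡0 i≢j (≢-sym i≢k) (≢-sym j≢k) ijk 2≤t))
      ... | no  _   | yes 2≤t | _       = triple-weights≤48-of-vanishing i≢j j≢k i≢k
        (Sum.[ (λ ji≡0 → inj₁ (trans (weight-sym i j) ji≡0)) , (λ ki≡0 → inj₂ (inj₂ (trans (weight-sym i k) ki≡0))) ]
          (noTriangle⇒weight≡0 j≢k i≢j i≢k (trans (sym (triangle-rotate i j k)) ijk) 2≤t))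
      ... | no  _   | no  _   | yes 2≤t = triple-weights≤48-of-vanishing i≢j j≢k i≢k
        (Sum.[ inj₁ , (λ kj≡0 → inj₂ (inj₁ (trans (weight-sym j k) kj≡0))) ]
          (noTriangle⇒weight≡0 i≢k (≢-sym i≢j) j≢k (trans (sym (triangle-swap i j k)) ijk) 2≤t))
      ... | no  t₁  | no  t₂  | no  t₃  =
        +-mono-≤ (+-mono-≤ (weight≤16 i≢j (≤-pred (≰⇒> t₁))) (weight≤16 j≢k (≤-pred (≰⇒> t₂)))) (weight≤16 i≢k (≤-pred (≰⇒> t₃)))

      triple-weights≤ : ∀ i j k → δ₃ i j k * (weight i j + weight j k + weight i k) ≤ 48 + 18 * (δ₃ i j k * 𝟙 (edge H (k ◂ pair i j)))
      triple-weights≤ i j k with δ₃-cases i j k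
      ... | inj₁ δ₃≡0 rewrite δ₃≡0 = z≤n
      ... | inj₂ (δ₃≡1 , i≢j , j≢k , i≢k) rewrite δ₃≡1 | +-identityʳ (weight i j + weight j k + weight i k)
        with edge H (k ◂ pair i j) Bool.≟ true
      ...   | yes ijk rewrite ijk = +-mono-≤ (+-mono-≤ (weight≤22 i≢j) (weight≤22 j≢k)) (weight≤22 i≢k)
      ...   | no ¬ijk rewrite ¬-not ¬ijk = triple-weights≤48 i≢j j≢k i≢k (¬-not ¬ijk)

      weight-average≤ : 3 * ((n ∸ 2) * (24 * (countOfSize 2 (edge H) + countOfSize 3 (edge H) + countOfSize 4 (edge H))))
                   ≤ n * (n * (n * 48)) + 18 * (n * (n * 2))
      weight-average≤ = begin
        3 * ((n ∸ 2) * (24 * (countOfSize 2 (edge H) + countOfSize 3 (edge H) + countOfSize 4 (edge H))))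
          ≡⟨ cong (λ x → 3 * ((n ∸ 2) * x)) ∑²-weight ⟨
        3 * ((n ∸ 2) * ∑² (λ a b → δᶜ a b * weight a b))
          ≡⟨ ∑³-δ₃-pairs weight weight-sym ⟨
        ∑³ (λ i j k → δ₃ i j k * (weight i j + weight j k + weight i k))
          ≤⟨ ∑³-mono-≤ triple-weights≤ ⟩
        ∑³ (λ i j k → 48 + 18 * T₃ i j k)
          ≡⟨ ∑³-distrib-+ (λ _ _ _ → 48) (λ i j k → 18 * T₃ i j k) ⟩
        ∑³ {n} (λ _ _ _ → 48) + ∑³ (λ i j k → 18 * T₃ i j k)
          ≤⟨ +-mono-≤ (∑³-≤-const {n} 48 (λ _ _ _ → ≤-refl)) (≤-reflexive (∑³-distribˡ 18 T₃)) ⟩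
        n * (n * (n * 48)) + 18 * ∑³ T₃
          ≡⟨ cong (λ x → n * (n * (n * 48)) + 18 * x) ∑³-triangles ⟩
        n * (n * (n * 48)) + 18 * ∑² (λ i j → δᶜ i j * triangles i j)
          ≤⟨ +-monoʳ-≤ (n * (n * (n * 48))) (*-monoʳ-≤ 18 (∑²-≤-const 2 δᶜ-triangles≤2)) ⟩
        n * (n * (n * 48)) + 18 * (n * (n * 2))
          ∎
        where
        open ≤-Reasoning
        T₃ : Fin n → Fin n → Fin n → ℕ
        T₃ i j k = δ₃ i j k * 𝟙 (edge H (k ◂ pair i j))
        δᶜ-triangles≤2 : ∀ i j → δᶜ i j * triangles i j ≤ 2
        δᶜ-triangles≤2 i j with i ≟ j
        ... | yes refl = z≤n
        ... | no i≢j   = ≤-trans (≤-reflexive (+-identityʳ (triangles i j))) (triangles≤2 i≢j)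

module UpperBound where

  open import Data.Nat using (ℕ; suc; _+_; _*_; _∸_; _≤_; _<_; _<?_; s≤s)
  open import Data.Nat.Properties using (m≤m+n; +-mono-≤; *-monoʳ-≤; *-cancelˡ-≤; ≮⇒≥; module ≤-Reasoning)
  open import Data.Nat.Tactic.RingSolver using (solve-∀)
  open import Data.Bool using (true)
  open import Data.Fin.Subset using (∣_∣)
  open import Relation.Nullary using (¬_; yes; no; contradiction)
  open import Relation.Binary.PropositionalEquality
  open import Defs using (Complex; edge; edgeCount; ContainsF)
  open Counting
  open Complexes
  open Weights

  cubic-cancel : ∀ {n} E → 4 ≤ n → 3 * ((n ∸ 2) * (24 * E)) ≤ n * (n * (n * 48)) + 18 * (n * (n * 2)) →
                 3 * E ≤ 2 * (n * n) + 12 * n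
  cubic-cancel {suc (suc (suc (suc m)))} E (s≤s (s≤s (s≤s (s≤s _)))) bound = *-cancelˡ-≤ (24 * (2 + m)) (begin
    24 * (2 + m) * (3 * E)                             ≡⟨ regroup (2 + m) E ⟩
    3 * ((2 + m) * (24 * E))                           ≤⟨ bound ⟩
    N * (N * (N * 48)) + 18 * (N * (N * 2))            ≤⟨ m≤m+n _ (12 * N * (13 * m + 4)) ⟩
    N * (N * (N * 48)) + 18 * (N * (N * 2)) + 12 * N * (13 * m + 4)
                                                       ≡⟨ expand m ⟩
    24 * (2 + m) * (2 * (N * N) + 12 * N)              ∎)
    where
    open ≤-Reasoning
    N = 4 + m
    regroup : ∀ a e → 24 * a * (3 * e) ≡ 3 * (a * (24 * e))
    regroup = solve-∀
    expand : ∀ m → (4 + m) * ((4 + m) * ((4 + m) * 48)) + 18 * ((4 + m) * ((4 + m) * 2)) + 12 * (4 + m) * (13 * m + 4)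
                   ≡ 24 * (2 + m) * (2 * ((4 + m) * (4 + m)) + 12 * (4 + m))
    expand = solve-∀

  upperBound : ∀ {n} (H : Complex n) → ¬ ContainsF H → 4 ≤ n → 3 * edgeCount H ≤ 2 * (n * n) + 15 * n + 3
  upperBound {n} H F-free 4≤n = begin
    3 * edgeCount H
      ≡⟨ cong (3 *_) (trans (length-filterᵇ-allSubsets n (edge H)) (count≡countBelow 5 (edge H) small)) ⟩
    3 * (c 4 + (c 3 + (c 2 + (c 1 + (c 0 + 0)))))
      ≡⟨ regroup (c 0) (c 1) (c 2) (c 3) (c 4) ⟩
    3 * c 0 + 3 * c 1 + 3 * (c 2 + c 3 + c 4)
      ≤⟨ +-mono-≤ (+-mono-≤ (*-monoʳ-≤ 3 (countOfSize₀≤1 (edge H))) (*-monoʳ-≤ 3 (countOfSize₁≤n (edge H))))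
                  (cubic-cancel (c 2 + c 3 + c 4) 4≤n (weight-average≤ H F-free)) ⟩
    3 * 1 + 3 * n + (2 * (n * n) + 12 * n)
      ≡⟨ collect n ⟩
    2 * (n * n) + 15 * n + 3
      ∎
    where
    open ≤-Reasoning
    c : ℕ → ℕ
    c k = countOfSize k (edge H)
    small : ∀ s → edge H s ≡ true → ∣ s ∣ < 5
    small s e with ∣ s ∣ <? 5
    ... | yes ∣s∣<5 = ∣s∣<5
    ... | no  ∣s∣≮5 = contradiction (containsF-of-large-edge H e (≮⇒≥ ∣s∣≮5)) F-free
    regroup : ∀ a b x y z → 3 * (z + (y + (x + (b + (a + 0))))) ≡ 3 * a + 3 * b + 3 * (x + y + z)
    regroup = solve-∀
    collect : ∀ n → 3 * 1 + 3 * n + (2 * (n * n) + 12 * n) ≡ 2 * (n * n) + 15 * n + 3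
    collect = solve-∀

module Modular where

  open import Data.Nat using (ℕ; zero; suc; _+_; _∸_; _≤_; _<_; _%_; NonZero)
  open import Data.Nat.Properties using (+-assoc; ≤-total; ≤-antisym; <⇒≱; ≤-<-trans; m∸n≤m; m+[n∸m]≡n; m∸n≡0⇒m≤n)
  open import Data.Nat.DivMod using (%-distribˡ-+; m%n%n≡m%n; m%n≤n; n%n≡0)
  open import Data.Nat.Divisibility using (_∣_; ∣m+n∣m⇒∣n; ∣⇒≤; m%n≡0⇒n∣m)
  open import Data.Sum using (inj₁; inj₂)
  open import Relation.Nullary using (contradiction)
  open import Relation.Binary.PropositionalEquality

  module _ (N : ℕ) .{{_ : NonZero N}} where

    ∣∧<⇒≡0 : ∀ {d} → N ∣ d → d < N → d ≡ 0
    ∣∧<⇒≡0 {zero}  _   _   = refl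
    ∣∧<⇒≡0 {suc d} N∣d d<N = contradiction (∣⇒≤ N∣d) (<⇒≱ d<N)

    %-cancelˡ-≤ : ∀ a {x y} → x ≤ y → y < N → (a + x) % N ≡ 0 → (a + y) % N ≡ 0 → x ≡ y
    %-cancelˡ-≤ a {x} {y} x≤y y<N a+x a+y = ≤-antisym x≤y (m∸n≡0⇒m≤n (∣∧<⇒≡0 N∣y∸x (≤-<-trans (m∸n≤m y x) y<N)))
      where
      split : a + x + (y ∸ x) ≡ a + y
      split = trans (+-assoc a x (y ∸ x)) (cong (a +_) (m+[n∸m]≡n x≤y))
      N∣y∸x : N ∣ y ∸ x
      N∣y∸x = ∣m+n∣m⇒∣n (subst (N ∣_) (sym split) (m%n≡0⇒n∣m (a + y) N a+y)) (m%n≡0⇒n∣m (a + x) N a+x)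

    %-cancelˡ : ∀ a {x y} → x < N → y < N → (a + x) % N ≡ 0 → (a + y) % N ≡ 0 → x ≡ y
    %-cancelˡ a {x} {y} x<N y<N a+x a+y with ≤-total x y
    ... | inj₁ x≤y = %-cancelˡ-≤ a x≤y y<N a+x a+y
    ... | inj₂ y≤x = sym (%-cancelˡ-≤ a y≤x x<N a+y a+x)

    %-complement : ∀ a → (a + (N ∸ a % N) % N) % N ≡ 0
    %-complement a = begin
      (a + (N ∸ r) % N) % N              ≡⟨ %-distribˡ-+ a ((N ∸ r) % N) N ⟩
      (a % N + (N ∸ r) % N % N) % N      ≡⟨ cong₂ (λ u v → (u + v) % N) (sym (m%n%n≡m%n a N)) (m%n%n≡m%n (N ∸ r) N) ⟩
      (r % N + (N ∸ r) % N) % N          ≡⟨ %-distribˡ-+ r (N ∸ r) N ⟨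
      (r + (N ∸ r)) % N                  ≡⟨ cong (_% N) (m+[n∸m]≡n (m%n≤n a N)) ⟩
      N % N                              ≡⟨ n%n≡0 N ⟩
      0                                  ∎
      where
      open ≡-Reasoning
      r = a % N

module ZeroSumComplex (m : ℕ) where

  open import Data.Nat using (zero; suc; _+_; _*_; _∸_; _≤_; _<_; _%_; _≤?_; _≟_; z≤n; s≤s)
  open import Data.Nat.Properties
    using (≤-trans; ≤-reflexive; ≰⇒>; ≤ᵇ⇒≤; m≤m+n; m≤n+m; *-identityˡ; *-identityʳ;
           +-monoˡ-≤; +-monoʳ-≤; *-monoʳ-≤; module ≤-Reasoning)
  open import Data.Nat.DivMod using (m%n<n)
  open import Data.Nat.Tactic.RingSolver using (solve-∀)
  open import Data.Bool using (Bool; true; not; _∨_; _∧_)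
  open import Data.Fin using (Fin; zero; suc; toℕ; fromℕ<)
  open import Data.Fin.Properties using (toℕ-injective; toℕ<n; toℕ-fromℕ<) renaming (_≟_ to _≟ᶠ_)
  open import Data.Fin.Subset using (Subset; ⊥; _⊆_; _∉_; ∣_∣)
  open import Data.Fin.Subset.Properties using (∉⊥; ∣⊥∣≡0; p⊆q⇒∣p∣≤∣q∣)
  open import Data.Vec using (lookup)
  open import Data.List.Relation.Unary.Any using (here; there)
  open import Data.Product using (_,_)
  open import Function using (id; _∘_)
  open import Relation.Nullary using (¬_; Dec; does; yes; no; contradiction)
  open import Relation.Nullary.Decidable using (dec-true; dec-false)
  open import Relation.Binary.PropositionalEquality
  open import Defs using (Complex; ContainsF; edgeCount)
  open Indicators
  open Sums
  open Subsets
  open Counting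
  open Modular

  N : ℕ
  N = suc m

  N∣ᵇ : ℕ → Bool
  N∣ᵇ r = does (r % N ≟ 0)

  isEdge : Subset N → Bool
  isEdge s = does (∣ s ∣ ≤? 2) ∨ (does (∣ s ∣ ≟ 3) ∧ N∣ᵇ (subsetSum s toℕ))

  isEdge-large : ∀ {s} → isEdge s ≡ true → ¬ ∣ s ∣ ≤ 2 → ∣ s ∣ ≡ 3
  isEdge-large {s} s-edge ∣s∣≰2 rewrite dec-false (∣ s ∣ ≤? 2) ∣s∣≰2 =
    let (∣s∣≟3 , _) = ∧-true s-edge in does-true (∣ s ∣ ≟ 3) ∣s∣≟3

  isEdge-small : ∀ s → isEdge s ≡ true → ∣ s ∣ < 4
  isEdge-small s s-edge with ∣ s ∣ ≤? 2
  ... | yes ∣s∣≤2 = s≤s (≤-trans ∣s∣≤2 (≤ᵇ⇒≤ 2 3 _))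
  ... | no  ∣s∣≰2 = ≤-reflexive (cong suc (isEdge-large {s} s-edge ∣s∣≰2))

  isEdge-downward : ∀ s t → t ⊆ s → isEdge s ≡ true → isEdge t ≡ true
  isEdge-downward s t t⊆s s-edge = small-or-whole (∣ t ∣ ≤? 2)
    where
    small-or-whole : Dec (∣ t ∣ ≤ 2) → isEdge t ≡ true
    small-or-whole (yes ∣t∣≤2) = cong (_∨ (does (∣ t ∣ ≟ 3) ∧ N∣ᵇ (subsetSum t toℕ))) (dec-true (∣ t ∣ ≤? 2) ∣t∣≤2)
    small-or-whole (no ∣t∣≰2)  = subst (λ u → isEdge u ≡ true) (sym t≡s) s-edge
      where
      ∣s∣≡3 : ∣ s ∣ ≡ 3
      ∣s∣≡3 = isEdge-large {s} s-edge (λ ∣s∣≤2 → ∣t∣≰2 (≤-trans (p⊆q⇒∣p∣≤∣q∣ t⊆s) ∣s∣≤2))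
      t≡s : t ≡ s
      t≡s = ⊆-∣∣-antisym t⊆s (≤-trans (≤-reflexive ∣s∣≡3) (≰⇒> ∣t∣≰2))

  Hₘ : Complex N
  Hₘ = record { edge = isEdge ; downward = isEdge-downward }

  isEdge-pair : ∀ a b → isEdge (pair a b) ≡ true
  isEdge-pair a b rewrite dec-true (∣ pair a b ∣ ≤? 2) (∣pair∣≤2 a b) = refl

  isEdge-triple : ∀ {x y z} → x ≢ y → x ≢ z → y ≢ z → isEdge (x ◂ y ◂ z ◂ ⊥) ≡ N∣ᵇ (toℕ x + toℕ y + toℕ z)
  isEdge-triple {x} {y} {z} x≢y x≢z y≢z =
    trans (cong (λ k → does (k ≤? 2) ∨ (does (k ≟ 3) ∧ N∣ᵇ (subsetSum (x ◂ y ◂ z ◂ ⊥) toℕ))) size) (cong N∣ᵇ elementSum)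
    where
    x∉yz : x ∉ y ◂ z ◂ ⊥
    x∉yz = ∉-◂ x≢y (∉-◂ x≢z ∉⊥)
    y∉z : y ∉ z ◂ ⊥
    y∉z = ∉-◂ y≢z ∉⊥
    z∉⊥ : z ∉ ⊥
    z∉⊥ = ∉⊥
    size : ∣ x ◂ y ◂ z ◂ ⊥ ∣ ≡ 3
    size = trans (∣x◂p∣≡1+∣p∣ x∉yz) (cong suc (trans (∣x◂p∣≡1+∣p∣ y∉z) (cong suc (trans (∣x◂p∣≡1+∣p∣ z∉⊥) (cong suc (∣⊥∣≡0 N))))))
    elementSum : subsetSum (x ◂ y ◂ z ◂ ⊥) toℕ ≡ toℕ x + toℕ y + toℕ z
    elementSum = begin
      subsetSum (x ◂ y ◂ z ◂ ⊥) toℕ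
        ≡⟨ subsetSum-◂ x∉yz toℕ ⟩
      toℕ x + subsetSum (y ◂ z ◂ ⊥) toℕ
        ≡⟨ cong (toℕ x +_) (trans (subsetSum-◂ y∉z toℕ) (cong (toℕ y +_) (trans (subsetSum-◂ z∉⊥ toℕ) (cong (toℕ z +_) (subsetSum-⊥ {N} toℕ))))) ⟩
      toℕ x + (toℕ y + (toℕ z + 0))
        ≡⟨ reassoc (toℕ x) (toℕ y) (toℕ z) ⟩
      toℕ x + toℕ y + toℕ z
        ∎
      where
      open ≡-Reasoning
      reassoc : ∀ a b c → a + (b + (c + 0)) ≡ a + b + c
      reassoc = solve-∀

  Hₘ-F-free : ¬ ContainsF Hₘ
  Hₘ-F-free (φ , φ-inj , F⊆H) = contradiction (φ-inj (toℕ-injective x₀≡x₃)) (λ ())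
    where
    φ≢ = injective⇒≢ φ-inj
    x₀ x₁ x₂ x₃ : ℕ
    x₀ = toℕ (φ zero)
    x₁ = toℕ (φ (suc zero))
    x₂ = toℕ (φ (suc (suc zero)))
    x₃ = toℕ (φ (suc (suc (suc zero))))
    v₁v₂v₃ : (x₀ + x₁ + x₂) % N ≡ 0
    v₁v₂v₃ = does-true (_ ≟ 0) (trans (sym (isEdge-triple (φ≢ λ ()) (φ≢ λ ()) (φ≢ λ ()))) (F⊆H _ (_ , here refl , id)))
    v₂v₃v₄ : (x₁ + x₂ + x₃) % N ≡ 0
    v₂v₃v₄ = does-true (_ ≟ 0) (trans (sym (isEdge-triple (φ≢ λ ()) (φ≢ λ ()) (φ≢ λ ()))) (F⊆H _ (_ , there (here refl) , id)))
    x₀≡x₃ : x₀ ≡ x₃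
    x₀≡x₃ = %-cancelˡ N (x₁ + x₂) (toℕ<n (φ zero)) (toℕ<n (φ (suc (suc (suc zero)))))
              (trans (cong (_% N) (rotate x₀ x₁ x₂)) v₁v₂v₃) v₂v₃v₄
      where
      rotate : ∀ a b c → b + c + a ≡ a + b + c
      rotate = solve-∀

  ∑-N∣ᵇ : ∀ a → ∑[ k < N ] 𝟙 (N∣ᵇ (a + toℕ k)) ≡ 1
  ∑-N∣ᵇ a = ∑-unique (λ k → N∣ᵇ (a + toℕ k)) k₀ (dec-true ((a + toℕ k₀) % N ≟ 0) k₀-solves) unique
    where
    k₀ : Fin N
    k₀ = fromℕ< (m%n<n (N ∸ a % N) N)
    k₀-solves : (a + toℕ k₀) % N ≡ 0
    k₀-solves = trans (cong (λ r → (a + r) % N) (toℕ-fromℕ< (m%n<n (N ∸ a % N) N))) (%-complement N a)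
    unique : ∀ k → N∣ᵇ (a + toℕ k) ≡ true → k ≡ k₀
    unique k k-solves = toℕ-injective (%-cancelˡ N a (toℕ<n k) (toℕ<n k₀) (does-true ((a + toℕ k) % N ≟ 0) k-solves) k₀-solves)

  ∑²-N∣ᵇ-iji : ∑² {N} (λ i j → 𝟙 (N∣ᵇ (toℕ i + toℕ j + toℕ i))) ≡ N
  ∑²-N∣ᵇ-iji = trans (∑²-rows 1 (λ i j → 𝟙 (N∣ᵇ (toℕ i + toℕ j + toℕ i))) row) (*-identityʳ N)
    where
    swap : ∀ a b → a + b + a ≡ a + a + b
    swap = solve-∀
    row : ∀ (i : Fin N) → ∑[ j < N ] 𝟙 (N∣ᵇ (toℕ i + toℕ j + toℕ i)) ≡ 1
    row i = trans (sum-cong-≗ {y = λ (j : Fin N) → 𝟙 (N∣ᵇ (toℕ i + toℕ i + toℕ j))} (λ j → cong (𝟙 ∘ N∣ᵇ) (swap (toℕ i) (toℕ j))))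
                  (∑-N∣ᵇ (toℕ i + toℕ i))

  ∑²-N∣ᵇ-ijj : ∑² {N} (λ i j → 𝟙 (N∣ᵇ (toℕ i + toℕ j + toℕ j))) ≡ N
  ∑²-N∣ᵇ-ijj = trans (∑²-columns 1 (λ i j → 𝟙 (N∣ᵇ (toℕ i + toℕ j + toℕ j))) column) (*-identityʳ N)
    where
    swap : ∀ a b → a + b + b ≡ b + b + a
    swap = solve-∀
    column : ∀ (j : Fin N) → ∑[ i < N ] 𝟙 (N∣ᵇ (toℕ i + toℕ j + toℕ j)) ≡ 1
    column j = trans (sum-cong-≗ {y = λ (i : Fin N) → 𝟙 (N∣ᵇ (toℕ j + toℕ j + toℕ i))} (λ i → cong (𝟙 ∘ N∣ᵇ) (swap (toℕ i) (toℕ j))))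
                     (∑-N∣ᵇ (toℕ j + toℕ j))

  -- The unique k with i + j + k ≡ 0 (mod N) is an apex of ij unless k = i or k = j.
  1≤apexes+degenerate : ∀ {i j} → i ≢ j →
    1 ≤ tuples 1 isEdge (pair i j) + (𝟙 (N∣ᵇ (toℕ i + toℕ j + toℕ i)) + 𝟙 (N∣ᵇ (toℕ i + toℕ j + toℕ j)))
  1≤apexes+degenerate {i} {j} i≢j = begin
    1                                                ≡⟨ ∑-N∣ᵇ a ⟨
    ∑[ k < N ] z k                                   ≤⟨ ∑-mono-≤ cover ⟩
    ∑[ k < N ] (E k + (δ i k * z k + δ j k * z k))   ≡⟨ ∑-distrib-+ E (λ k → δ i k * z k + δ j k * z k) ⟩
    tuples 1 isEdge (pair i j) + ∑[ k < N ] (δ i k * z k + δ j k * z k)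
      ≡⟨ cong (tuples 1 isEdge (pair i j) +_) (trans (∑-distrib-+ (λ k → δ i k * z k) (λ k → δ j k * z k))
                                                     (cong₂ _+_ (∑-δ i z) (∑-δ j z))) ⟩
    tuples 1 isEdge (pair i j) + (z i + z j)         ∎
    where
    open ≤-Reasoning
    a = toℕ i + toℕ j
    z E : Fin N → ℕ
    z k = 𝟙 (N∣ᵇ (a + toℕ k))
    E k = 𝟙 (not (lookup (pair i j) k)) * 𝟙 (isEdge (k ◂ pair i j))
    z≡E : ∀ {k} → i ≢ k → j ≢ k → z k ≡ E k
    z≡E {k} i≢k j≢k = sym (begin-equality
      E k                                             ≡⟨ cong (_* 𝟙 (isEdge (k ◂ pair i j))) (𝟙-∉-pair i j k) ⟩
      δᶜ j k * δᶜ i k * 𝟙 (isEdge (k ◂ pair i j))     ≡⟨ cong₂ (λ u v → u * v * 𝟙 (isEdge (k ◂ pair i j))) (δᶜ-≢ j≢k) (δᶜ-≢ i≢k) ⟩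
      1 * 1 * 𝟙 (isEdge (k ◂ pair i j))               ≡⟨ *-identityˡ (𝟙 (isEdge (k ◂ pair i j))) ⟩
      𝟙 (isEdge (k ◂ pair i j))                       ≡⟨ cong 𝟙 (isEdge-triple (≢-sym j≢k) (≢-sym i≢k) (≢-sym i≢j)) ⟩
      𝟙 (N∣ᵇ (toℕ k + toℕ j + toℕ i))                 ≡⟨ cong (𝟙 ∘ N∣ᵇ) (reverse (toℕ k) (toℕ j) (toℕ i)) ⟩
      z k                                             ∎)
      where
      reverse : ∀ x y z → x + y + z ≡ z + y + x
      reverse = solve-∀
    cover : ∀ k → z k ≤ E k + (δ i k * z k + δ j k * z k)
    cover k = cases (i ≟ᶠ k) (j ≟ᶠ k)
      where
      cases : Dec (i ≡ k) → Dec (j ≡ k) → z k ≤ E k + (δ i k * z k + δ j k * z k)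
      cases (yes refl) _        rewrite δ-refl i | *-identityˡ (z i) = ≤-trans (m≤m+n (z i) _) (m≤n+m _ (E i))
      cases (no _)     (yes refl) rewrite δ-refl j | *-identityˡ (z j) = ≤-trans (m≤n+m (z j) _) (m≤n+m _ (E j))
      cases (no i≢k)   (no j≢k) = ≤-trans (≤-reflexive (z≡E i≢k j≢k)) (m≤m+n (E k) _)

  ∑²-δᶜ≤tuples₃ : ∑² (δᶜ {N}) ≤ tuples 3 isEdge ⊥ + (N + N)
  ∑²-δᶜ≤tuples₃ = begin
    ∑² (δᶜ {N})                                                        ≤⟨ ∑²-mono-≤ pointwise ⟩
    ∑² (λ i j → δᶜ i j * tuples 1 isEdge (pair i j) + degenerate i j)  ≡⟨ ∑²-distrib-+ (λ i j → δᶜ i j * tuples 1 isEdge (pair i j)) degenerate ⟩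
    ∑² (λ i j → δᶜ i j * tuples 1 isEdge (pair i j)) + ∑² degenerate
      ≡⟨ cong₂ _+_ (∑²-pairs-tuples 1 isEdge) (trans (∑²-distrib-+ iji ijj) (cong₂ _+_ ∑²-N∣ᵇ-iji ∑²-N∣ᵇ-ijj)) ⟩
    tuples 3 isEdge ⊥ + (N + N)                                        ∎
    where
    open ≤-Reasoning
    iji ijj degenerate : Fin N → Fin N → ℕ
    iji i j = 𝟙 (N∣ᵇ (toℕ i + toℕ j + toℕ i))
    ijj i j = 𝟙 (N∣ᵇ (toℕ i + toℕ j + toℕ j))
    degenerate i j = iji i j + ijj i j
    pointwise : ∀ i j → δᶜ i j ≤ δᶜ i j * tuples 1 isEdge (pair i j) + degenerate i j
    pointwise i j = cases (i ≟ᶠ j)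
      where
      cases : Dec (i ≡ j) → δᶜ i j ≤ δᶜ i j * tuples 1 isEdge (pair i j) + degenerate i j
      cases (yes refl) rewrite δᶜ-refl i = z≤n
      cases (no i≢j)   rewrite δᶜ-≢ i≢j | *-identityˡ (tuples 1 isEdge (pair i j)) = 1≤apexes+degenerate i≢j

  lowerBound : 4 * (N * N) ≤ 6 * edgeCount Hₘ + 6 * N
  lowerBound = begin
    4 * (N * N)                                    ≡⟨ cong (4 *_) (∑²-δᶜ {N}) ⟨
    4 * (D + N)                                    ≡⟨ split (D + N) ⟩
    3 * (D + N) + (D + N)                          ≤⟨ +-monoʳ-≤ (3 * (D + N)) (+-monoˡ-≤ N ∑²-δᶜ≤tuples₃) ⟩
    3 * (D + N) + (tuples 3 isEdge ⊥ + (N + N) + N) ≡⟨ cong₂ (λ x y → 3 * (x + N) + (y + (N + N) + N)) D≡ (tuples-⊥ 3 isEdge) ⟩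
    3 * (2 * c 2 + N) + (6 * c 3 + (N + N) + N)    ≡⟨ collect (c 2) (c 3) N ⟩
    6 * (c 2 + c 3) + 6 * N                        ≤⟨ +-monoˡ-≤ (6 * N) (*-monoʳ-≤ 6 c₂+c₃≤) ⟩
    6 * edgeCount Hₘ + 6 * N                       ∎
    where
    open ≤-Reasoning
    D = ∑² (δᶜ {N})
    c : ℕ → ℕ
    c k = countOfSize k isEdge
    D≡ : D ≡ 2 * c 2
    D≡ = trans (∑²-cong (λ i j → trans (sym (*-identityʳ (δᶜ i j))) (cong (λ b → δᶜ i j * 𝟙 b) (sym (isEdge-pair i j)))))
               (trans (∑²-pairs-tuples 0 isEdge) (tuples-⊥ 2 isEdge))
    c₂+c₃≤ : c 2 + c 3 ≤ edgeCount Hₘ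
    c₂+c₃≤ = begin
      c 2 + c 3                             ≤⟨ m≤n+m (c 2 + c 3) (c 0 + c 1) ⟩
      c 0 + c 1 + (c 2 + c 3)               ≡⟨ regroup (c 0) (c 1) (c 2) (c 3) ⟩
      c 3 + (c 2 + (c 1 + (c 0 + 0)))       ≡⟨ trans (length-filterᵇ-allSubsets N isEdge) (count≡countBelow 4 isEdge isEdge-small) ⟨
      edgeCount Hₘ                          ∎
      where
      regroup : ∀ a b x y → a + b + (x + y) ≡ y + (x + (b + (a + 0)))
      regroup = solve-∀
    split : ∀ x → 4 * x ≡ 3 * x + x
    split = solve-∀
    collect : ∀ a b n → 3 * (2 * a + n) + (6 * b + (n + n) + n) ≡ 6 * (a + b) + 6 * n
    collect = solve-∀

module RationalBounds where

  open import Data.Nat as ℕ using (suc)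
  open import Data.Nat.Properties using (*-identityʳ)
  open import Data.Integer as ℤ using (ℤ; +_; +[1+_]; -[1+_]; +≤+)
  open import Data.Integer.Properties using (pos-*; pos-+; +-monoˡ-≤)
  open import Data.Integer.Tactic.RingSolver using (solve-∀)
  open import Data.Rational using (mkℚ; _/_; toℚᵘ; _+_; _-_; _*_; _≤_)
  open import Data.Rational.Properties using (normalize-coprime; toℚᵘ-cancel-≤; toℚᵘ-homo-*; toℚᵘ-homo-+; toℚᵘ-homo‿-)
  open import Data.Rational.Unnormalised as ℚᵘ using (mkℚᵘ; *≤*; _≃_)
  open import Data.Rational.Unnormalised.Properties using (≃-sym; ≃-trans; ≃-reflexive; *-cong; +-congʳ; ≤-respˡ-≃; ≤-respʳ-≃)
  open import Data.Nat.Coprimality using (Coprime; 1-coprimeTo) renaming (sym to coprime-sym)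
  open import Relation.Binary.PropositionalEquality
  open import Defs using (ℕtoℚ)

  ℕtoℚ≡mkℚ : ∀ k → ℕtoℚ k ≡ mkℚ (+ k) 0 (coprime-sym (1-coprimeTo k))
  ℕtoℚ≡mkℚ k = normalize-coprime (coprime-sym (1-coprimeTo k))

  module _ {p d : ℕ} .(c : Coprime (suc p) (suc d)) where

    toℚᵘ-4/3+ε : ∀ C → toℚᵘ ((+ 4 / 3 + mkℚ +[1+ p ] d c) * ℕtoℚ C) ≃ (mkℚᵘ (+ 4) 2 ℚᵘ.+ mkℚᵘ +[1+ p ] d) ℚᵘ.* mkℚᵘ (+ C) 0
    toℚᵘ-4/3+ε C = ≃-trans (toℚᵘ-homo-* (+ 4 / 3 + mkℚ +[1+ p ] d c) (ℕtoℚ C))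
                           (*-cong (toℚᵘ-homo-+ (+ 4 / 3) (mkℚ +[1+ p ] d c)) (≃-reflexive (cong toℚᵘ (ℕtoℚ≡mkℚ C))))

    toℚᵘ-4/3-ε : ∀ C → toℚᵘ ((+ 4 / 3 - mkℚ +[1+ p ] d c) * ℕtoℚ C) ≃ (mkℚᵘ (+ 4) 2 ℚᵘ.+ mkℚᵘ -[1+ p ] d) ℚᵘ.* mkℚᵘ (+ C) 0
    toℚᵘ-4/3-ε C = ≃-trans (toℚᵘ-homo-* (+ 4 / 3 - mkℚ +[1+ p ] d c) (ℕtoℚ C))
                           (*-cong (≃-trans (toℚᵘ-homo-+ (+ 4 / 3) (Data.Rational.- mkℚ +[1+ p ] d c))
                                            (+-congʳ (mkℚᵘ (+ 4) 2) (toℚᵘ-homo‿- (mkℚ +[1+ p ] d c))))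
                                   (≃-reflexive (cong toℚᵘ (ℕtoℚ≡mkℚ C))))

    ≤-4/3+ε : ∀ e C → e ℕ.* (3 ℕ.* suc d) ℕ.≤ (4 ℕ.* suc d ℕ.+ 3 ℕ.* suc p) ℕ.* C →
              ℕtoℚ e ≤ (+ 4 / 3 + mkℚ +[1+ p ] d c) * ℕtoℚ C
    ≤-4/3+ε e C e≤ = toℚᵘ-cancel-≤ (≤-respʳ-≃ (≃-sym (toℚᵘ-4/3+ε C))
                                     (subst (ℚᵘ._≤ _) (sym (cong toℚᵘ (ℕtoℚ≡mkℚ e))) (*≤* (subst₂ ℤ._≤_ lhs rhs (+≤+ e≤)))))
      where
      lhs : + (e ℕ.* (3 ℕ.* suc d)) ≡ + e ℤ.* + (3 ℕ.* suc d ℕ.* 1)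
      lhs = trans (pos-* e (3 ℕ.* suc d)) (cong (λ x → + e ℤ.* + x) (sym (*-identityʳ (3 ℕ.* suc d))))
      rhs : + ((4 ℕ.* suc d ℕ.+ 3 ℕ.* suc p) ℕ.* C) ≡ ((+ 4 ℤ.* + suc d ℤ.+ + suc p ℤ.* + 3) ℤ.* + C) ℤ.* + 1
      rhs = trans (pos-* (4 ℕ.* suc d ℕ.+ 3 ℕ.* suc p) C)
                  (trans (cong (ℤ._* + C) (trans (pos-+ (4 ℕ.* suc d) (3 ℕ.* suc p)) (cong₂ ℤ._+_ (pos-* 4 (suc d)) (pos-* 3 (suc p)))))
                         (reorder (+ suc d) (+ suc p) (+ C)))
        where
        reorder : ∀ x y z → (+ 4 ℤ.* x ℤ.+ + 3 ℤ.* y) ℤ.* z ≡ ((+ 4 ℤ.* x ℤ.+ y ℤ.* + 3) ℤ.* z) ℤ.* + 1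
        reorder = solve-∀

    4/3-ε≤ : ∀ e C → 4 ℕ.* suc d ℕ.* C ℕ.≤ e ℕ.* (3 ℕ.* suc d) ℕ.+ 3 ℕ.* suc p ℕ.* C →
             (+ 4 / 3 - mkℚ +[1+ p ] d c) * ℕtoℚ C ≤ ℕtoℚ e
    4/3-ε≤ e C ≤e = toℚᵘ-cancel-≤ (≤-respˡ-≃ (≃-sym (toℚᵘ-4/3-ε C))
                                    (subst (_ ℚᵘ.≤_) (sym (cong toℚᵘ (ℕtoℚ≡mkℚ e))) (*≤* (subst₂ ℤ._≤_ lhs rhs difference))))
      where
      A = 4 ℕ.* suc d ℕ.* C
      B = 3 ℕ.* suc p ℕ.* C
      R = e ℕ.* (3 ℕ.* suc d)
      difference : + A ℤ.- + B ℤ.≤ + R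
      difference = subst (+ A ℤ.- + B ℤ.≤_) (cancel (+ R) (+ B)) (+-monoˡ-≤ (ℤ.- + B) (subst (+ A ℤ.≤_) (pos-+ R B) (+≤+ ≤e)))
        where
        cancel : ∀ r b → r ℤ.+ b ℤ.- b ≡ r
        cancel = solve-∀
      lhs : + A ℤ.- + B ≡ ((+ 4 ℤ.* + suc d ℤ.+ -[1+ p ] ℤ.* + 3) ℤ.* + C) ℤ.* + 1
      lhs = trans (cong₂ ℤ._-_ (trans (pos-* (4 ℕ.* suc d) C) (cong (ℤ._* + C) (pos-* 4 (suc d))))
                               (trans (pos-* (3 ℕ.* suc p) C) (cong (ℤ._* + C) (pos-* 3 (suc p)))))
                  (reorder (+ suc d) (+ suc p) (+ C))
        where
        reorder : ∀ x y z → + 4 ℤ.* x ℤ.* z ℤ.- + 3 ℤ.* y ℤ.* z ≡ ((+ 4 ℤ.* x ℤ.+ (ℤ.- y) ℤ.* + 3) ℤ.* z) ℤ.* + 1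
        reorder = solve-∀
      rhs : + R ≡ + e ℤ.* + (3 ℕ.* suc d ℕ.* 1)
      rhs = trans (pos-* e (3 ℕ.* suc d)) (cong (λ x → + e ℤ.* + x) (sym (*-identityʳ (3 ℕ.* suc d))))

module Asymptotics where

  open import Data.Nat using (zero; suc; _+_; _*_; _∸_; _≤_)
  open import Data.Nat.Properties
    using (≤-trans; ≤-reflexive; m≤m+n; m∸n+n≡m; *-identityˡ; +-monoʳ-≤; *-monoʳ-≤; *-monoˡ-≤; *-cancelˡ-≤; +-cancelʳ-≤; module ≤-Reasoning)
  open import Data.Nat.Combinatorics using (_C_; nC1≡n; nCk+nC[k+1]≡[n+1]C[k+1])
  open import Data.Nat.Tactic.RingSolver using (solve-∀)
  open import Relation.Binary.PropositionalEquality

  2·nC2+n≡n² : ∀ n → 2 * (n C 2) + n ≡ n * n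
  2·nC2+n≡n² zero    = refl
  2·nC2+n≡n² (suc n) = begin
    2 * (suc n C 2) + suc n               ≡⟨ cong (λ x → 2 * x + suc n) (nCk+nC[k+1]≡[n+1]C[k+1] n 1) ⟨
    2 * (n C 1 + n C 2) + suc n           ≡⟨ cong (λ x → 2 * (x + n C 2) + suc n) (nC1≡n n) ⟩
    2 * (n + n C 2) + suc n               ≡⟨ regroup n (n C 2) ⟩
    2 * (n C 2) + n + (2 * n + 1)         ≡⟨ cong (_+ (2 * n + 1)) (2·nC2+n≡n² n) ⟩
    n * n + (2 * n + 1)                   ≡⟨ square n ⟩
    suc n * suc n                         ∎
    where
    open ≡-Reasoning
    regroup : ∀ n c → 2 * (n + c) + suc n ≡ 2 * c + n + (2 * n + 1)
    regroup = solve-∀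
    square : ∀ n → n * n + (2 * n + 1) ≡ suc n * suc n
    square = solve-∀

  module _ (D P : ℕ) (1≤P : 1 ≤ P) {n : ℕ} (n≥ : 12 * D + 20 ≤ n) where

    linear≤3·nC2 : D * (17 * n + 3) ≤ P * (3 * (n C 2))
    linear≤3·nC2 = begin
      D * (17 * n + 3)         ≤⟨ *-cancelˡ-≤ 2 (+-cancelʳ-≤ (3 * n) _ _ twice) ⟩
      3 * (n C 2)              ≡⟨ *-identityˡ (3 * (n C 2)) ⟨
      1 * (3 * (n C 2))        ≤⟨ *-monoˡ-≤ (3 * (n C 2)) 1≤P ⟩
      P * (3 * (n C 2))        ∎
      where
      open ≤-Reasoning
      t = n ∸ (12 * D + 20)
      n≡ : n ≡ t + (12 * D + 20)
      n≡ = sym (m∸n+n≡m n≥)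
      slack = 24 * (D * D) + 718 * D + 38 * (D * t) + 3 * (t * t) + 117 * t + 1140
      expand : ∀ t D → 2 * (D * (17 * (t + (12 * D + 20)) + 3)) + 3 * (t + (12 * D + 20))
                         + (24 * (D * D) + 718 * D + 38 * (D * t) + 3 * (t * t) + 117 * t + 1140)
                       ≡ 3 * ((t + (12 * D + 20)) * (t + (12 * D + 20)))
      expand = solve-∀
      regroup : ∀ c n → 3 * (2 * c + n) ≡ 2 * (3 * c) + 3 * n
      regroup = solve-∀
      twice : 2 * (D * (17 * n + 3)) + 3 * n ≤ 2 * (3 * (n C 2)) + 3 * n
      twice = begin
        2 * (D * (17 * n + 3)) + 3 * n              ≤⟨ m≤m+n _ slack ⟩
        2 * (D * (17 * n + 3)) + 3 * n + slack      ≡⟨ cong (λ x → 2 * (D * (17 * x + 3)) + 3 * x + slack) n≡ ⟩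
        2 * (D * (17 * (t + (12 * D + 20)) + 3)) + 3 * (t + (12 * D + 20)) + slack
                                                    ≡⟨ expand t D ⟩
        3 * ((t + (12 * D + 20)) * (t + (12 * D + 20))) ≡⟨ cong (λ x → 3 * (x * x)) n≡ ⟨
        3 * (n * n)                                 ≡⟨ cong (3 *_) (2·nC2+n≡n² n) ⟨
        3 * (2 * (n C 2) + n)                       ≡⟨ regroup (n C 2) n ⟩
        2 * (3 * (n C 2)) + 3 * n                   ∎

    upper-arith : ∀ e → 3 * e ≤ 2 * (n * n) + 15 * n + 3 → e * (3 * D) ≤ (4 * D + 3 * P) * (n C 2)
    upper-arith e 3e≤ = begin
      e * (3 * D)                               ≡⟨ swap e D ⟩
      D * (3 * e)                               ≤⟨ *-monoʳ-≤ D 3e≤ ⟩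
      D * (2 * (n * n) + 15 * n + 3)            ≡⟨ cong (λ x → D * (2 * x + 15 * n + 3)) (2·nC2+n≡n² n) ⟨
      D * (2 * (2 * (n C 2) + n) + 15 * n + 3)  ≡⟨ expand D (n C 2) n ⟩
      4 * D * (n C 2) + D * (17 * n + 3)        ≤⟨ +-monoʳ-≤ (4 * D * (n C 2)) linear≤3·nC2 ⟩
      4 * D * (n C 2) + P * (3 * (n C 2))       ≡⟨ collect D P (n C 2) ⟩
      (4 * D + 3 * P) * (n C 2)                 ∎
      where
      open ≤-Reasoning
      swap : ∀ e D → e * (3 * D) ≡ D * (3 * e)
      swap = solve-∀
      expand : ∀ D c n → D * (2 * (2 * c + n) + 15 * n + 3) ≡ 4 * D * c + D * (17 * n + 3)
      expand = solve-∀
      collect : ∀ D P c → 4 * D * c + P * (3 * c) ≡ (4 * D + 3 * P) * c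
      collect = solve-∀

    lower-arith : ∀ e → 4 * (n * n) ≤ 6 * e + 6 * n → 4 * D * (n C 2) ≤ e * (3 * D) + 3 * P * (n C 2)
    lower-arith e 4n²≤ = begin
      4 * D * (n C 2)                            ≡⟨ swap D (n C 2) ⟩
      D * (4 * (n C 2))                          ≤⟨ *-monoʳ-≤ D 4C≤ ⟩
      D * (3 * e + n)                            ≡⟨ expand D e n ⟩
      e * (3 * D) + D * n                        ≤⟨ +-monoʳ-≤ (e * (3 * D)) Dn≤ ⟩
      e * (3 * D) + 3 * P * (n C 2)              ∎
      where
      open ≤-Reasoning
      swap : ∀ D c → 4 * D * c ≡ D * (4 * c)
      swap = solve-∀
      expand : ∀ D e n → D * (3 * e + n) ≡ e * (3 * D) + D * n
      expand = solve-∀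
      4C≤ : 4 * (n C 2) ≤ 3 * e + n
      4C≤ = *-cancelˡ-≤ 2 (+-cancelʳ-≤ (4 * n) _ _ (begin
        2 * (4 * (n C 2)) + 4 * n          ≡⟨ regroup (n C 2) n ⟩
        4 * (2 * (n C 2) + n)              ≡⟨ cong (4 *_) (2·nC2+n≡n² n) ⟩
        4 * (n * n)                        ≤⟨ 4n²≤ ⟩
        6 * e + 6 * n                      ≡⟨ split e n ⟩
        2 * (3 * e + n) + 4 * n            ∎))
        where
        regroup : ∀ c n → 2 * (4 * c) + 4 * n ≡ 4 * (2 * c + n)
        regroup = solve-∀
        split : ∀ e n → 6 * e + 6 * n ≡ 2 * (3 * e + n) + 4 * n
        split = solve-∀
      Dn≤ : D * n ≤ 3 * P * (n C 2)
      Dn≤ = ≤-trans (*-monoʳ-≤ D (≤-trans (m≤m+n n (16 * n + 3)) (≤-reflexive (sym (seventeen n)))))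
                    (≤-trans linear≤3·nC2 (≤-reflexive (reassoc P (n C 2))))
        where
        seventeen : ∀ n → 17 * n + 3 ≡ n + (16 * n + 3)
        seventeen = solve-∀
        reassoc : ∀ P c → P * (3 * c) ≡ 3 * P * c
        reassoc = solve-∀

open import Defs
open import Data.Nat using (ℕ; _≥_)
open import Data.Integer using (+_)
open import Data.Rational using (ℚ; _/_; _+_; _-_; _*_; _≤_; _>_; 0ℚ)
open import Data.Product using (_×_; ∃-syntax)
open import Relation.Nullary using (¬_)

open import Data.Nat using (zero; suc; s≤s; z≤n) renaming (_+_ to _+ℕ_; _*_ to _*ℕ_; _≤_ to _≤ℕ_)
open import Data.Nat.Properties using (≤-trans; m≤n+m; ≤ᵇ⇒≤)
open import Data.Nat.Combinatorics using (_C_)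
open import Data.Integer using (+[1+_]; -[1+_]; +<+)
open import Data.Rational using (mkℚ; *<*)
open import Data.Product using (_,_)
open UpperBound using (upperBound)
open ZeroSumComplex using (Hₘ; Hₘ-F-free; lowerBound)
open RationalBounds using (≤-4/3+ε; 4/3-ε≤)
open Asymptotics using (upper-arith; lower-arith)

corollary1p6 : ∀ (ε : ℚ) → ε > 0ℚ → ∃[ n₀ ] ∀ (n : ℕ) → n ≥ n₀ →
    (∃[ H ] (¬ ContainsF {n} H × ((+ 4 / 3) - ε) * choose2ℚ n ≤ ℕtoℚ (edgeCount H)))
    × (∀ (H : Complex n) → ¬ ContainsF H → ℕtoℚ (edgeCount H) ≤ ((+ 4 / 3) + ε) * choose2ℚ n)
corollary1p6 (mkℚ (+ zero) d c) (*<* (+<+ ()))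
corollary1p6 (mkℚ -[1+ p ] d c) (*<* ())
corollary1p6 (mkℚ +[1+ p ] d c) _ = n₀ , λ n n≥n₀ → lower n n≥n₀ , upper n n≥n₀
  where
  -- ε ≥ 1/(d + 1), and from n₀ on the O(n) error terms of both bounds are at most ε · binom(n, 2).
  n₀ = 12 *ℕ suc d +ℕ 20
  lower : ∀ n → n ≥ n₀ →
          ∃[ H ] (¬ ContainsF {n} H × ((+ 4 / 3) - mkℚ +[1+ p ] d c) * choose2ℚ n ≤ ℕtoℚ (edgeCount H))
  lower zero    ()
  lower (suc m) n≥n₀ =
    Hₘ m , Hₘ-F-free m ,
    4/3-ε≤ c (edgeCount (Hₘ m)) (suc m C 2) (lower-arith (suc d) (suc p) (s≤s z≤n) n≥n₀ (edgeCount (Hₘ m)) (lowerBound m))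
  upper : ∀ n → n ≥ n₀ → ∀ (H : Complex n) → ¬ ContainsF H →
          ℕtoℚ (edgeCount H) ≤ ((+ 4 / 3) + mkℚ +[1+ p ] d c) * choose2ℚ n
  upper n n≥n₀ H F-free =
    ≤-4/3+ε c (edgeCount H) (n C 2) (upper-arith (suc d) (suc p) (s≤s z≤n) n≥n₀ (edgeCount H) (upperBound H F-free 4≤n))
    where
    4≤n : 4 ≤ℕ n
    4≤n = ≤-trans (≤ᵇ⇒≤ 4 20 _) (≤-trans (m≤n+m 20 (12 *ℕ suc d)) n≥n₀)
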